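{- Let $\ell$ be an odd prime, $\zeta_\ell\in\mathbb{C}$ a primitive $\ell$-th root of unity, $\alpha_\ell=\frac{(\zeta_\ell-\zeta_\ell^{ -1})^{2(\ell-1)}}{\ell^2}$ and $\delta_\ell=\frac{2-\zeta_\ell-\zeta_\ell^{ -1}}{\ell}$. Then there exists an injective morphism of lattices $I_{\alpha_\ell}\hookrightarrow I_{\delta_\ell}$.
   Context: For a totally real $\beta\in\mathbb{Q}(\zeta_\ell)$, $I_\beta$ is the ideal lattice consisting of the $\mathbb{Z}$-module $\mathbb{Z}[\zeta_\ell]$ with bilinear form $\langle x,y\rangle_\beta=\mathrm{tr}_{\mathbb{Q}(\zeta_\ell)/\mathbb{Q}}(\beta x\bar y)$ (bar = complex conjugation). A morphism of lattices is a $\mathbb{Z}$-linear map preserving the bilinear forms. -}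

module Defs where

open import Data.Nat as ℕ using (ℕ; zero; suc; NonZero; _∸_)
open import Data.Nat.DivMod using (_mod_)
open import Data.Integer as ℤ using (ℤ; +_)
open import Data.Rational as ℚ using (ℚ; 0ℚ; 1ℚ)
open import Data.Fin as Fin using (Fin; toℕ)
open import Data.Vec as Vec using (Vec; lookup; zipWith; map)
open import Data.Product using (Σ; _×_)
open import Relation.Binary.PropositionalEquality using (_≡_)
open import Relation.Nullary using (yes; no)

∑ : ∀ {n} → (Fin n → ℚ) → ℚ
∑ {zero}  f = 0ℚ
∑ {suc n} f = f Fin.zero ℚ.+ ∑ (λ i → f (Fin.suc i))

ℤ→ℚ : ℤ → ℚ
ℤ→ℚ z = z ℚ./ 1

ℕ→ℚ : ℕ → ℚ
ℕ→ℚ n = + n ℚ./ 1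

module _ (ℓ : ℕ) .{{_ : NonZero ℓ}} where

  -- The group ring ℚ[C_ℓ] = ℚ[x]/(x^ℓ - 1); its quotient by ℚ·(1+x+…+x^{ℓ-1})
  -- is ℚ(ζ_ℓ) with ζ_ℓ ↦ x.  Elements: coefficient functions.
  GR : Set
  GR = Fin ℓ → ℚ

  mono : ℕ → GR
  mono m j with j Fin.≟ (m mod ℓ)
  ... | yes _ = 1ℚ
  ... | no  _ = 0ℚ

  _⊕_ : GR → GR → GR
  (a ⊕ b) j = a j ℚ.+ b j

  _⊖_ : GR → GR → GR
  (a ⊖ b) j = a j ℚ.- b j

  _·_ : ℚ → GR → GR
  (c · a) j = c ℚ.* a j

  _⊛_ : GR → GR → GR
  (a ⊛ b) k = ∑ (λ i → a i ℚ.* b (((toℕ k ℕ.+ ℓ) ∸ toℕ i) mod ℓ))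

  one : GR
  one = mono 0

  _^^_ : GR → ℕ → GR
  a ^^ zero  = one
  a ^^ suc n = a ⊛ (a ^^ n)

  -- complex conjugation: x^i ↦ x^{-i}
  conj : GR → GR
  conj a j = a ((ℓ ∸ toℕ j) mod ℓ)

  -- tr_{ℚ(ζ_ℓ)/ℚ}(ζ_ℓ^i) = ℓ-1 if ℓ ∣ i, and -1 otherwise
  trMono : Fin ℓ → ℚ
  trMono j with toℕ j ℕ.≟ 0
  ... | yes _ = ℕ→ℚ (ℓ ∸ 1)
  ... | no  _ = ℚ.- 1ℚ

  tr : GR → ℚ
  tr a = ∑ (λ j → a j ℚ.* trMono j)

  -- The ℤ-module ℤ[ζ_ℓ], in coordinates w.r.t. its ℤ-basis 1, ζ, …, ζ^{ℓ-2}
  ℤζ : Set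
  ℤζ = Vec ℤ (ℓ ∸ 1)

  emb : ℤζ → GR
  emb v = λ j → ∑ (λ i → ℤ→ℚ (lookup v i) ℚ.* mono (toℕ i) j)

  -- the ideal lattice I_β : ⟨x,y⟩_β = tr(β x ȳ)
  form : GR → ℤζ → ℤζ → ℚ
  form β x y = tr (β ⊛ (emb x ⊛ conj (emb y)))

  IsLatticeMorphism : GR → GR → (ℤζ → ℤζ) → Set
  IsLatticeMorphism β γ f =
    (∀ x y → f (zipWith ℤ._+_ x y) ≡ zipWith ℤ._+_ (f x) (f y)) ×
    (∀ (c : ℤ) x → f (map (c ℤ.*_) x) ≡ map (c ℤ.*_) (f x)) ×
    (∀ x y → form γ (f x) (f y) ≡ form β x y)

  Injective : (ℤζ → ℤζ) → Set
  Injective f = ∀ x y → f x ≡ f y → x ≡ y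

  module _ (k : ℕ) where
    -- ζ := x^k (a primitive ℓ-th root of unity when ℓ ∤ k)
    ζ : GR
    ζ = mono k

    αℓ : GR
    αℓ = ((+ 1 ℚ./ ℓ) ℚ.* (+ 1 ℚ./ ℓ)) · ((ζ ⊖ conj ζ) ^^ (2 ℕ.* (ℓ ∸ 1)))

    δℓ : GR
    δℓ = (+ 1 ℚ./ ℓ) · (((ℕ→ℚ 2 · one) ⊖ ζ) ⊖ conj ζ)

-- Write ℓ = m + 1, p = 1 - ζ and u = 1 + ζ. Since ζ ζ̄ = 1 we have ℓ δ = 2 - ζ - ζ̄ = p p̄ and
-- (ζ - ζ̄)² = -(p p̄)(u ū); as m is even, ℓ² α = (p p̄)^m (u ū)^m. Expanding 1 = ζ^ℓ = (1 + (ζ - 1))^ℓ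
-- and using ℓ ∣ C(ℓ, i) for 0 < i < ℓ gives p^m = ℓ E with E ∈ ℤ[ζ]. The Gauss sum g = Σ_a ζ^{a²}
-- satisfies g ḡ = ℓ, and ḡ = p h with h ∈ ℤ[ζ] because p divides every ζ^e - 1. Hence w = E u^m h
-- lies in ℤ[ζ], is invertible in ℚ(ζ), and δ w w̄ = E Ē (u ū)^m (p h)(p̄ h̄)/ℓ = E Ē (u ū)^m = α,
-- so multiplication by w is an injective morphism I_α → I_δ.
module Submission where

open import Algebra.Bundles using (CommutativeRing; RawRing)
open import Algebra.Definitions using (RightInvertible)
import Algebra.Properties.CommutativeMonoid.Sum as CommutativeMonoidSum
import Algebra.Properties.CommutativeSemigroup as CommutativeSemigroupProperties
import Algebra.Properties.CommutativeSemiring.Binomial as CommutativeBinomial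
import Algebra.Properties.CommutativeSemiring.Exp as CommutativeExp
import Algebra.Properties.Group as GroupProperties
import Algebra.Properties.Ring as RingProperties
import Algebra.Properties.Semiring.Exp as Exp
import Algebra.Properties.Semiring.Mult as Mult
import Algebra.Properties.Semiring.Sum as SemiringSum
import Algebra.Solver.Ring as RingSolver
open import Algebra.Solver.Ring.AlmostCommutativeRing using (fromCommutativeRing; _-Raw-AlmostCommutative⟶_)
open import Data.Empty using (⊥-elim)
open import Data.Fin as Fin using (Fin; toℕ) renaming (zero to fzero; suc to fsuc)
open import Data.Fin.Permutation using (permutation)
import Data.Fin.Properties as Finₚ
import Data.Fin.Relation.Unary.Top as Top
open import Data.Integer as ℤ using (ℤ; +_)
import Data.Integer.Properties as ℤₚ
open import Data.Integer.Tactic.RingSolver using () renaming (solve-∀ to solveℤ-∀)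
open import Data.Maybe using (Maybe; just; nothing)
open import Data.Nat as ℕ using (ℕ; zero; suc; _∸_; NonZero; _≤_; _<_)
open import Data.Nat.Combinatorics using (_C_; nC1≡n; nCn≡1; nCk+nC[k+1]≡[n+1]C[k+1])
open import Data.Nat.Coprimality using (1-coprimeTo; coprime-Bézout; prime⇒coprime)
import Data.Nat.Coprimality as Coprime
open import Data.Nat.DivMod using (_%_; _mod_)
import Data.Nat.DivMod as DivMod
open import Data.Nat.Divisibility using (_∣_; _∤_; divides; ∣-refl; ∣m∣n⇒∣m+n; >⇒∤; m%n≡0⇒n∣m)
open import Data.Nat.GCD using (module Bézout)
open import Data.Nat.Primality using (Prime; euclidsLemma; prime⇒irreducible; prime⇒nonTrivial)
import Data.Nat.Properties as ℕₚ
open import Data.Nat.Tactic.RingSolver using (solve-∀)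
open import Data.Product using (Σ; _×_; _,_; proj₁; proj₂; map₂)
open import Data.Rational as ℚ using (ℚ; 0ℚ; 1ℚ; mkℚ)
import Data.Rational.Properties as ℚₚ
open import Data.Rational.Solver using (module +-*-Solver)
open import Data.Sum using (_⊎_; inj₁; inj₂)
open import Data.Vec using (lookup; tabulate; zipWith)
import Data.Vec as Vec
import Data.Vec.Properties as Vecₚ
open import Data.Vec.Relation.Binary.Pointwise.Extensional using (ext; Pointwise-≡⇒≡)
open import Function using (_∘_)
open import Relation.Binary.Bundles using (Setoid)
import Relation.Binary.PropositionalEquality as ≡
open import Relation.Binary.PropositionalEquality using (_≡_; _≢_; refl; sym; trans; cong; cong₂; module ≡-Reasoning)
import Relation.Binary.Reasoning.Setoid as SetoidReasoning
open import Relation.Binary.Structures using (IsEquivalence)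
open import Relation.Nullary using (Dec; yes; no)

open import Defs using (∑; ℤ→ℚ; ℕ→ℚ; ℤζ; IsLatticeMorphism; Injective; αℓ; δℓ)
import Defs as D

ℤ→ℚ≡mkℚ : ∀ z → ℤ→ℚ z ≡ mkℚ z 0 (Coprime.sym (1-coprimeTo _))
ℤ→ℚ≡mkℚ z = ℚₚ.↥p/↧p≡p (mkℚ z 0 (Coprime.sym (1-coprimeTo _)))

ℤ→ℚ-+ : ∀ a b → ℤ→ℚ (a ℤ.+ b) ≡ ℤ→ℚ a ℚ.+ ℤ→ℚ b
ℤ→ℚ-+ a b rewrite ℤ→ℚ≡mkℚ a | ℤ→ℚ≡mkℚ b =
  cong (ℚ._/ 1) (sym (cong₂ ℤ._+_ (ℤₚ.*-identityʳ a) (ℤₚ.*-identityʳ b)))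

ℤ→ℚ-* : ∀ a b → ℤ→ℚ (a ℤ.* b) ≡ ℤ→ℚ a ℚ.* ℤ→ℚ b
ℤ→ℚ-* a b rewrite ℤ→ℚ≡mkℚ a | ℤ→ℚ≡mkℚ b = refl

ℤ→ℚ-‿ : ∀ a → ℤ→ℚ (ℤ.- a) ≡ ℚ.- ℤ→ℚ a
ℤ→ℚ-‿ a = trans (ℤ→ℚ≡mkℚ (ℤ.- a)) (trans (mkℚ-‿ a) (cong ℚ.-_ (sym (ℤ→ℚ≡mkℚ a))))
  where
  mkℚ-‿ : ∀ a → mkℚ (ℤ.- a) 0 (Coprime.sym (1-coprimeTo _)) ≡ ℚ.- mkℚ a 0 (Coprime.sym (1-coprimeTo _))
  mkℚ-‿ (+ zero)    = refl
  mkℚ-‿ (+ suc n)   = refl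
  mkℚ-‿ ℤ.-[1+ n ] = refl

ℤ→ℚ-injective : ∀ {a b} → ℤ→ℚ a ≡ ℤ→ℚ b → a ≡ b
ℤ→ℚ-injective {a} {b} eq = cong ℚ.numerator (trans (sym (ℤ→ℚ≡mkℚ a)) (trans eq (ℤ→ℚ≡mkℚ b)))

module ℚΣ = CommutativeMonoidSum ℚₚ.+-0-commutativeMonoid

∑≡sum : ∀ {n} (f : Fin n → ℚ) → ∑ f ≡ ℚΣ.sum f
∑≡sum {zero}  f = refl
∑≡sum {suc n} f = cong (f fzero ℚ.+_) (∑≡sum (f ∘ fsuc))

∑-cong : ∀ {n} {f g : Fin n → ℚ} → (∀ i → f i ≡ g i) → ∑ f ≡ ∑ g
∑-cong {zero}  f≗g = refl
∑-cong {suc n} f≗g = cong₂ ℚ._+_ (f≗g fzero) (∑-cong (f≗g ∘ fsuc))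

∑-zero : ∀ n → ∑ {n} (λ _ → 0ℚ) ≡ 0ℚ
∑-zero zero    = refl
∑-zero (suc n) = trans (cong (0ℚ ℚ.+_) (∑-zero n)) refl

∑-distrib-+ : ∀ {n} (f g : Fin n → ℚ) → ∑ (λ i → f i ℚ.+ g i) ≡ ∑ f ℚ.+ ∑ g
∑-distrib-+ f g = begin
  ∑ (λ i → f i ℚ.+ g i)         ≡⟨ ∑≡sum (λ i → f i ℚ.+ g i) ⟩
  ℚΣ.sum (λ i → f i ℚ.+ g i)    ≡⟨ ℚΣ.∑-distrib-+ f g ⟩
  ℚΣ.sum f ℚ.+ ℚΣ.sum g         ≡⟨ sym (cong₂ ℚ._+_ (∑≡sum f) (∑≡sum g)) ⟩
  ∑ f ℚ.+ ∑ g                   ∎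
  where open ≡-Reasoning

∑-*ˡ : ∀ {n} c (f : Fin n → ℚ) → ∑ (λ i → c ℚ.* f i) ≡ c ℚ.* ∑ f
∑-*ˡ {zero}  c f = sym (ℚₚ.*-zeroʳ c)
∑-*ˡ {suc n} c f =
  trans (cong (c ℚ.* f fzero ℚ.+_) (∑-*ˡ c (f ∘ fsuc))) (sym (ℚₚ.*-distribˡ-+ c (f fzero) _))

∑-*ʳ : ∀ {n} c (f : Fin n → ℚ) → ∑ (λ i → f i ℚ.* c) ≡ ∑ f ℚ.* c
∑-*ʳ c f = trans (∑-cong (λ i → ℚₚ.*-comm (f i) c)) (trans (∑-*ˡ c f) (ℚₚ.*-comm c _))

∑-comm : ∀ {m n} (f : Fin m → Fin n → ℚ) → ∑ (λ i → ∑ (f i)) ≡ ∑ (λ j → ∑ (λ i → f i j))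
∑-comm f = begin
  ∑ (λ i → ∑ (f i))                     ≡⟨ ∑-cong (λ i → ∑≡sum (f i)) ⟩
  ∑ (λ i → ℚΣ.sum (f i))                ≡⟨ ∑≡sum (λ i → ℚΣ.sum (f i)) ⟩
  ℚΣ.sum (λ i → ℚΣ.sum (f i))           ≡⟨ ℚΣ.∑-comm f ⟩
  ℚΣ.sum (λ j → ℚΣ.sum (λ i → f i j))   ≡⟨ sym (∑≡sum (λ j → ℚΣ.sum (λ i → f i j))) ⟩
  ∑ (λ j → ℚΣ.sum (λ i → f i j))        ≡⟨ sym (∑-cong (λ j → ∑≡sum (λ i → f i j))) ⟩
  ∑ (λ j → ∑ (λ i → f i j))             ∎
  where open ≡-Reasoning

∑-reindex : ∀ {n} (f : Fin n → ℚ) (σ τ : Fin n → Fin n) →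
            (∀ j → σ (τ j) ≡ j) → (∀ i → τ (σ i) ≡ i) → ∑ (f ∘ σ) ≡ ∑ f
∑-reindex f σ τ στ τσ = begin
  ∑ (f ∘ σ)       ≡⟨ ∑≡sum (f ∘ σ) ⟩
  ℚΣ.sum (f ∘ σ)  ≡⟨ sym (ℚΣ.∑-permute f (permutation σ τ στ τσ)) ⟩
  ℚΣ.sum f        ≡⟨ sym (∑≡sum f) ⟩
  ∑ f             ∎
  where open ≡-Reasoning

∑-indicator : ∀ {n} (d f : Fin n → ℚ) j → d j ≡ 1ℚ → (∀ i → i ≢ j → d i ≡ 0ℚ) →
              ∑ (λ i → d i ℚ.* f i) ≡ f j
∑-indicator {suc n} d f fzero dj≡1 d≡0 = begin
  d fzero ℚ.* f fzero ℚ.+ ∑ (λ i → d (fsuc i) ℚ.* f (fsuc i))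
    ≡⟨ cong₂ (λ a b → a ℚ.* f fzero ℚ.+ b) dj≡1 (∑-cong (λ i → cong (ℚ._* f (fsuc i)) (d≡0 (fsuc i) λ ()))) ⟩
  1ℚ ℚ.* f fzero ℚ.+ ∑ (λ i → 0ℚ ℚ.* f (fsuc i))
    ≡⟨ cong₂ ℚ._+_ (ℚₚ.*-identityˡ (f fzero)) (trans (∑-cong (λ i → ℚₚ.*-zeroˡ (f (fsuc i)))) (∑-zero n)) ⟩
  f fzero ℚ.+ 0ℚ
    ≡⟨ ℚₚ.+-identityʳ _ ⟩
  f fzero ∎
  where open ≡-Reasoning
∑-indicator {suc n} d f (fsuc j) dj≡1 d≡0 = begin
  d fzero ℚ.* f fzero ℚ.+ ∑ (λ i → d (fsuc i) ℚ.* f (fsuc i))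
    ≡⟨ cong₂ ℚ._+_ (trans (cong (ℚ._* f fzero) (d≡0 fzero λ ())) (ℚₚ.*-zeroˡ (f fzero)))
                   (∑-indicator (d ∘ fsuc) (f ∘ fsuc) j dj≡1 (λ i i≢j → d≡0 (fsuc i) (i≢j ∘ Finₚ.suc-injective))) ⟩
  0ℚ ℚ.+ f (fsuc j)
    ≡⟨ ℚₚ.+-identityˡ _ ⟩
  f (fsuc j) ∎
  where open ≡-Reasoning

∑-const : ∀ n c → ∑ {n} (λ _ → c) ≡ ℕ→ℚ n ℚ.* c
∑-const zero    c = sym (ℚₚ.*-zeroˡ c)
∑-const (suc n) c = begin
  c ℚ.+ ∑ {n} (λ _ → c)          ≡⟨ cong (c ℚ.+_) (∑-const n c) ⟩
  c ℚ.+ ℕ→ℚ n ℚ.* c              ≡⟨ solve 2 (λ c x → c :+ x :* c := (con 1ℚ :+ x) :* c) refl c (ℕ→ℚ n) ⟩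
  (1ℚ ℚ.+ ℕ→ℚ n) ℚ.* c           ≡⟨ cong (ℚ._* c) (sym (ℤ→ℚ-+ (+ 1) (+ n))) ⟩
  ℕ→ℚ (suc n) ℚ.* c              ∎
  where open ≡-Reasoning
        open +-*-Solver

IsInteger : ℚ → Set
IsInteger q = Σ ℤ λ z → q ≡ ℤ→ℚ z

isInteger-+ : ∀ {p q} → IsInteger p → IsInteger q → IsInteger (p ℚ.+ q)
isInteger-+ (a , p≡a) (b , q≡b) = a ℤ.+ b , trans (cong₂ ℚ._+_ p≡a q≡b) (sym (ℤ→ℚ-+ a b))

isInteger-* : ∀ {p q} → IsInteger p → IsInteger q → IsInteger (p ℚ.* q)
isInteger-* (a , p≡a) (b , q≡b) = a ℤ.* b , trans (cong₂ ℚ._*_ p≡a q≡b) (sym (ℤ→ℚ-* a b))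

isInteger-‿ : ∀ {q} → IsInteger q → IsInteger (ℚ.- q)
isInteger-‿ (a , q≡a) = ℤ.- a , trans (cong ℚ.-_ q≡a) (sym (ℤ→ℚ-‿ a))

isInteger-∑ : ∀ {n} (f : Fin n → ℚ) → (∀ i → IsInteger (f i)) → IsInteger (∑ f)
isInteger-∑ {zero}  f _     = + 0 , refl
isInteger-∑ {suc n} f isInt = isInteger-+ (isInt fzero) (isInteger-∑ (f ∘ fsuc) (isInt ∘ fsuc))

[1+k]*[1+n]C[1+k]≡[1+n]*nCk : ∀ n k → suc k ℕ.* (suc n C suc k) ≡ suc n ℕ.* (n C k)
[1+k]*[1+n]C[1+k]≡[1+n]*nCk zero    zero    = refl
[1+k]*[1+n]C[1+k]≡[1+n]*nCk zero    (suc k) = ℕₚ.*-zeroʳ (suc (suc k))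
[1+k]*[1+n]C[1+k]≡[1+n]*nCk (suc n) zero    =
  trans (ℕₚ.*-identityˡ _) (trans (nC1≡n (suc (suc n))) (sym (ℕₚ.*-identityʳ (suc (suc n)))))
[1+k]*[1+n]C[1+k]≡[1+n]*nCk (suc n) (suc k) = begin
  suc K ℕ.* (suc N C suc K)                     ≡⟨ cong (suc K ℕ.*_) (sym (nCk+nC[k+1]≡[n+1]C[k+1] N K)) ⟩
  suc K ℕ.* (X ℕ.+ Y)                           ≡⟨ rearrange K X Y ⟩
  X ℕ.+ K ℕ.* X ℕ.+ suc K ℕ.* Y                 ≡⟨ cong₂ (λ a b → X ℕ.+ a ℕ.+ b) ([1+k]*[1+n]C[1+k]≡[1+n]*nCk n k)
                                                                                 ([1+k]*[1+n]C[1+k]≡[1+n]*nCk n (suc k)) ⟩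
  X ℕ.+ N ℕ.* (n C k) ℕ.+ N ℕ.* (n C K)         ≡⟨ ℕₚ.+-assoc X _ _ ⟩
  X ℕ.+ (N ℕ.* (n C k) ℕ.+ N ℕ.* (n C K))       ≡⟨ cong (X ℕ.+_) (sym (ℕₚ.*-distribˡ-+ N (n C k) (n C K))) ⟩
  X ℕ.+ N ℕ.* (n C k ℕ.+ n C K)                 ≡⟨ cong (λ t → X ℕ.+ N ℕ.* t) (nCk+nC[k+1]≡[n+1]C[k+1] n k) ⟩
  X ℕ.+ N ℕ.* X                                 ∎
  where
  open ≡-Reasoning
  N = suc n
  K = suc k
  X = N C K
  Y = N C suc K
  rearrange : ∀ K X Y → suc K ℕ.* (X ℕ.+ Y) ≡ X ℕ.+ K ℕ.* X ℕ.+ suc K ℕ.* Y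
  rearrange = solve-∀

prime∣pC[1+k] : ∀ {n} → Prime (suc n) → ∀ k → k ℕ.< n → suc n ∣ suc n C suc k
prime∣pC[1+k] {n} isPrime k k<n
  with euclidsLemma (suc k) (suc n C suc k) isPrime
         (divides (n C k) (trans ([1+k]*[1+n]C[1+k]≡[1+n]*nCk n k) (ℕₚ.*-comm (suc n) (n C k))))
... | inj₁ p∣1+k = ⊥-elim (>⇒∤ (ℕ.s≤s k<n) p∣1+k)
... | inj₂ p∣pCk = p∣pCk

2∣n⊎2∣1+n : ∀ n → 2 ∣ n ⊎ 2 ∣ suc n
2∣n⊎2∣1+n zero = inj₁ (divides 0 refl)
2∣n⊎2∣1+n (suc n) with 2∣n⊎2∣1+n n
... | inj₁ 2∣n   = inj₂ (∣m∣n⇒∣m+n ∣-refl 2∣n)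
... | inj₂ 2∣1+n = inj₁ 2∣1+n

odd-prime⇒2∣pred : ∀ {m} → Prime (suc m) → suc m ≢ 2 → 2 ∣ m
odd-prime⇒2∣pred {m} isPrime odd with 2∣n⊎2∣1+n m
... | inj₁ 2∣m = 2∣m
... | inj₂ 2∣1+m with prime⇒irreducible isPrime 2∣1+m
...   | inj₁ ()
...   | inj₂ 2≡1+m = ⊥-elim (odd (sym 2≡1+m))

module CommutativeRingProperties {c r} (R : CommutativeRing c r) where

  open CommutativeRing R renaming (refl to ≈-refl; sym to ≈-sym; trans to ≈-trans)
  open Exp semiring using (_^_; ^-congˡ; ^-congʳ; ^-assocʳ)
  open CommutativeExp commutativeSemiring using (^-distrib-*)
  open SetoidReasoning setoid

  Unit : Carrier → Set _
  Unit = RightInvertible _≈_ 1# _*_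

  1^n≈1 : ∀ n → 1# ^ n ≈ 1#
  1^n≈1 zero    = ≈-refl
  1^n≈1 (suc n) = ≈-trans (*-identityˡ (1# ^ n)) (1^n≈1 n)

  unit-* : ∀ {x y} → Unit x → Unit y → Unit (x * y)
  unit-* {x} {y} (x⁻¹ , xx⁻¹≈1) (y⁻¹ , yy⁻¹≈1) = x⁻¹ * y⁻¹ , (begin
    (x * y) * (x⁻¹ * y⁻¹)     ≈⟨ interchange x y x⁻¹ y⁻¹ ⟩
    (x * x⁻¹) * (y * y⁻¹)     ≈⟨ *-cong xx⁻¹≈1 yy⁻¹≈1 ⟩
    1# * 1#                   ≈⟨ *-identityˡ 1# ⟩
    1#                        ∎)
    where open CommutativeSemigroupProperties *-commutativeSemigroup using (interchange)

  unit-^ : ∀ {x} → Unit x → ∀ n → Unit (x ^ n)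
  unit-^ {x} (x⁻¹ , xx⁻¹≈1) n = x⁻¹ ^ n , (begin
    x ^ n * x⁻¹ ^ n           ≈⟨ ≈-sym (^-distrib-* x x⁻¹ n) ⟩
    (x * x⁻¹) ^ n             ≈⟨ ^-congˡ n xx⁻¹≈1 ⟩
    1# ^ n                    ≈⟨ 1^n≈1 n ⟩
    1#                        ∎)

  unit-cancelˡ : ∀ {x a b} → Unit x → x * a ≈ x * b → a ≈ b
  unit-cancelˡ {x} {a} {b} (x⁻¹ , xx⁻¹≈1) xa≈xb = begin
    a                         ≈⟨ ≈-sym (*-identityˡ a) ⟩
    1# * a                    ≈⟨ *-congʳ (≈-trans (≈-sym xx⁻¹≈1) (*-comm x x⁻¹)) ⟩
    (x⁻¹ * x) * a             ≈⟨ *-assoc x⁻¹ x a ⟩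
    x⁻¹ * (x * a)             ≈⟨ *-congˡ xa≈xb ⟩
    x⁻¹ * (x * b)             ≈⟨ ≈-sym (*-assoc x⁻¹ x b) ⟩
    (x⁻¹ * x) * b             ≈⟨ *-congʳ (≈-trans (*-comm x⁻¹ x) xx⁻¹≈1) ⟩
    1# * b                    ≈⟨ *-identityˡ b ⟩
    b                         ∎

  -x*-y≈x*y : ∀ x y → (- x) * (- y) ≈ x * y
  -x*-y≈x*y x y = begin
    (- x) * (- y)             ≈⟨ ≈-sym (-‿distribˡ-* x (- y)) ⟩
    - (x * (- y))             ≈⟨ -‿cong (≈-sym (-‿distribʳ-* x y)) ⟩
    - (- (x * y))             ≈⟨ ⁻¹-involutive (x * y) ⟩
    x * y                     ∎
    where
    open RingProperties ring using (-‿distribˡ-*; -‿distribʳ-*)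
    open GroupProperties +-group using (⁻¹-involutive)

  unit-‿ : ∀ {x} → Unit x → Unit (- x)
  unit-‿ {x} (x⁻¹ , xx⁻¹≈1) = - x⁻¹ , ≈-trans (-x*-y≈x*y x x⁻¹) xx⁻¹≈1

  ^-neg-even : ∀ x {n} → 2 ∣ n → (- x) ^ n ≈ x ^ n
  ^-neg-even x {n} (divides h ≡.refl) = begin
    (- x) ^ (h ℕ.* 2)         ≈⟨ ^-congʳ (- x) (ℕₚ.*-comm h 2) ⟩
    (- x) ^ (2 ℕ.* h)         ≈⟨ ≈-sym (^-assocʳ (- x) 2 h) ⟩
    ((- x) ^ 2) ^ h           ≈⟨ ^-congˡ h (*-congˡ (*-identityʳ (- x))) ⟩
    ((- x) * (- x)) ^ h       ≈⟨ ^-congˡ h (-x*-y≈x*y x x) ⟩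
    (x * x) ^ h               ≈⟨ ≈-sym (^-congˡ h (*-congˡ (*-identityʳ x))) ⟩
    (x ^ 2) ^ h               ≈⟨ ^-assocʳ x 2 h ⟩
    x ^ (2 ℕ.* h)             ≈⟨ ^-congʳ x (ℕₚ.*-comm 2 h) ⟩
    x ^ (h ℕ.* 2)             ∎

ℤ-rawRing : RawRing _ _
ℤ-rawRing = CommutativeRing.rawRing ℤₚ.+-*-commutativeRing

module Cyclotomic (m : ℕ) where

  ℓ : ℕ
  ℓ = suc m

  -- Arithmetic modulo ℓ

  infix 4 _≡ₘ_
  record _≡ₘ_ (a b : ℕ) : Set where
    constructor mod-eq
    field %≡% : a % ℓ ≡ b % ℓ
  open _≡ₘ_

  ≡ₘ-isEquivalence : IsEquivalence _≡ₘ_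
  ≡ₘ-isEquivalence = record
    { refl  = mod-eq refl
    ; sym   = λ a≡b → mod-eq (sym (%≡% a≡b))
    ; trans = λ a≡b b≡c → mod-eq (trans (%≡% a≡b) (%≡% b≡c))
    }

  ≡ₘ-setoid : Setoid _ _
  ≡ₘ-setoid = record { isEquivalence = ≡ₘ-isEquivalence }

  open IsEquivalence ≡ₘ-isEquivalence public
    using () renaming (refl to ≡ₘ-refl; sym to ≡ₘ-sym; trans to ≡ₘ-trans; reflexive to ≡⇒≡ₘ)

  +-congₘ : ∀ {a b c d} → a ≡ₘ b → c ≡ₘ d → a ℕ.+ c ≡ₘ b ℕ.+ d
  +-congₘ {a} {b} {c} {d} (mod-eq a≡b) (mod-eq c≡d) = mod-eq (begin
    (a ℕ.+ c) % ℓ            ≡⟨ DivMod.%-distribˡ-+ a c ℓ ⟩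
    (a % ℓ ℕ.+ c % ℓ) % ℓ    ≡⟨ cong₂ (λ x y → (x ℕ.+ y) % ℓ) a≡b c≡d ⟩
    (b % ℓ ℕ.+ d % ℓ) % ℓ    ≡⟨ sym (DivMod.%-distribˡ-+ b d ℓ) ⟩
    (b ℕ.+ d) % ℓ            ∎)
    where open ≡-Reasoning

  *-congₘ : ∀ {a b c d} → a ≡ₘ b → c ≡ₘ d → a ℕ.* c ≡ₘ b ℕ.* d
  *-congₘ {a} {b} {c} {d} (mod-eq a≡b) (mod-eq c≡d) = mod-eq (begin
    (a ℕ.* c) % ℓ                ≡⟨ DivMod.%-distribˡ-* a c ℓ ⟩
    (a % ℓ ℕ.* (c % ℓ)) % ℓ      ≡⟨ cong₂ (λ x y → (x ℕ.* y) % ℓ) a≡b c≡d ⟩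
    (b % ℓ ℕ.* (d % ℓ)) % ℓ      ≡⟨ sym (DivMod.%-distribˡ-* b d ℓ) ⟩
    (b ℕ.* d) % ℓ                ∎)
    where open ≡-Reasoning

  %≡ₘ : ∀ a → a % ℓ ≡ₘ a
  %≡ₘ a = mod-eq (DivMod.m%n%n≡m%n a ℓ)

  +ℓ≡ₘ : ∀ a → a ℕ.+ ℓ ≡ₘ a
  +ℓ≡ₘ a = mod-eq (DivMod.[m+n]%n≡m%n a ℓ)

  *ℓ≡ₘ0 : ∀ a → a ℕ.* ℓ ≡ₘ 0
  *ℓ≡ₘ0 a = mod-eq (DivMod.m*n%n≡0 a ℓ)

  ℓ≡ₘ0 : ℓ ≡ₘ 0
  ℓ≡ₘ0 = mod-eq (DivMod.n%n≡0 ℓ)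

  +-cancelʳ-≡ₘ : ∀ a b c → a ℕ.+ c ≡ₘ b ℕ.+ c → a ≡ₘ b
  +-cancelʳ-≡ₘ a b c a+c≡b+c = begin
    a                          ≈⟨ ≡ₘ-sym (mod-eq (DivMod.[m+kn]%n≡m%n a c ℓ)) ⟩
    a ℕ.+ c ℕ.* ℓ              ≡⟨ split a ⟩
    (a ℕ.+ c) ℕ.+ c ℕ.* m      ≈⟨ +-congₘ a+c≡b+c ≡ₘ-refl ⟩
    (b ℕ.+ c) ℕ.+ c ℕ.* m      ≡⟨ sym (split b) ⟩
    b ℕ.+ c ℕ.* ℓ              ≈⟨ mod-eq (DivMod.[m+kn]%n≡m%n b c ℓ) ⟩
    b                          ∎
    where
    open SetoidReasoning ≡ₘ-setoid
    split : ∀ x → x ℕ.+ c ℕ.* ℓ ≡ (x ℕ.+ c) ℕ.+ c ℕ.* m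
    split x = trans (cong (x ℕ.+_) (ℕₚ.*-suc c m)) (sym (ℕₚ.+-assoc x c (c ℕ.* m)))

  [_] : ℕ → Fin ℓ
  [ a ] = a mod ℓ

  toℕ-[] : ∀ a → toℕ [ a ] ≡ₘ a
  toℕ-[] a = ≡ₘ-trans (≡⇒≡ₘ (Finₚ.toℕ-fromℕ< (DivMod.m%n<n a ℓ))) (%≡ₘ a)

  toℕ-injectiveₘ : ∀ {i j : Fin ℓ} → toℕ i ≡ₘ toℕ j → i ≡ j
  toℕ-injectiveₘ {i} {j} (mod-eq i≡j) = Finₚ.toℕ-injective (begin
    toℕ i          ≡⟨ sym (DivMod.m<n⇒m%n≡m (Finₚ.toℕ<n i)) ⟩
    toℕ i % ℓ      ≡⟨ i≡j ⟩
    toℕ j % ℓ      ≡⟨ DivMod.m<n⇒m%n≡m (Finₚ.toℕ<n j) ⟩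
    toℕ j          ∎)
    where open ≡-Reasoning

  []-cong : ∀ {a b} → a ≡ₘ b → [ a ] ≡ [ b ]
  []-cong {a} {b} a≡b = toℕ-injectiveₘ (≡ₘ-trans (toℕ-[] a) (≡ₘ-trans a≡b (≡ₘ-sym (toℕ-[] b))))

  []-toℕ : ∀ (i : Fin ℓ) → [ toℕ i ] ≡ i
  []-toℕ i = toℕ-injectiveₘ (toℕ-[] (toℕ i))

  <ℓ⇒invertibleₘ : Prime ℓ → ∀ r .{{_ : NonZero r}} → r < ℓ → Σ ℕ λ r′ → r ℕ.* r′ ≡ₘ 1
  <ℓ⇒invertibleₘ isPrime r r<ℓ with coprime-Bézout (prime⇒coprime isPrime r<ℓ)
  ... | Bézout.-+ x y 1+xℓ≡yr = y , (begin
    r ℕ.* y             ≡⟨ ℕₚ.*-comm r y ⟩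
    y ℕ.* r             ≡⟨ sym 1+xℓ≡yr ⟩
    1 ℕ.+ x ℕ.* ℓ       ≈⟨ +-congₘ (≡ₘ-refl {1}) (*ℓ≡ₘ0 x) ⟩
    1                   ∎)
    where open SetoidReasoning ≡ₘ-setoid
  ... | Bézout.+- x y 1+yr≡xℓ = y ℕ.* m , +-cancelʳ-≡ₘ _ 1 m (begin
    r ℕ.* (y ℕ.* m) ℕ.+ m     ≡⟨ rearrange r y m ⟩
    (1 ℕ.+ y ℕ.* r) ℕ.* m     ≡⟨ cong (ℕ._* m) 1+yr≡xℓ ⟩
    x ℕ.* ℓ ℕ.* m             ≈⟨ *-congₘ (*ℓ≡ₘ0 x) ≡ₘ-refl ⟩
    0                         ≈⟨ ≡ₘ-sym ℓ≡ₘ0 ⟩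
    1 ℕ.+ m                   ∎)
    where
    open SetoidReasoning ≡ₘ-setoid
    rearrange : ∀ r y m → r ℕ.* (y ℕ.* m) ℕ.+ m ≡ (1 ℕ.+ y ℕ.* r) ℕ.* m
    rearrange = solve-∀

  ∤⇒invertibleₘ : Prime ℓ → ∀ {c} → ℓ ∤ c → Σ ℕ λ c′ → c ℕ.* c′ ≡ₘ 1
  ∤⇒invertibleₘ isPrime {c} ℓ∤c with c % ℓ in c%ℓ≡r
  ... | zero    = ⊥-elim (ℓ∤c (m%n≡0⇒n∣m c ℓ c%ℓ≡r))
  ... | r@(suc _) = map₂ (≡ₘ-trans (*-congₘ c≡r ≡ₘ-refl)) (<ℓ⇒invertibleₘ isPrime r r<ℓ)
    where
    c≡r : c ≡ₘ r
    c≡r = ≡ₘ-trans (≡ₘ-sym (%≡ₘ c)) (≡⇒≡ₘ c%ℓ≡r)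
    r<ℓ : r < ℓ
    r<ℓ = ≡.subst (_< ℓ) c%ℓ≡r (DivMod.m%n<n c ℓ)

  infixl 6 _-ᶠ_ _+ᶠ_
  _-ᶠ_ _+ᶠ_ : Fin ℓ → Fin ℓ → Fin ℓ
  k -ᶠ i = [ toℕ k ℕ.+ ℓ ∸ toℕ i ]
  i +ᶠ j = [ toℕ i ℕ.+ toℕ j ]

  neg : Fin ℓ → Fin ℓ
  neg i = fzero -ᶠ i

  toℕ-ᶠ : ∀ k i → toℕ (k -ᶠ i) ℕ.+ toℕ i ≡ₘ toℕ k
  toℕ-ᶠ k i = begin
    toℕ (k -ᶠ i) ℕ.+ toℕ i             ≈⟨ +-congₘ (toℕ-[] (toℕ k ℕ.+ ℓ ∸ toℕ i)) ≡ₘ-refl ⟩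
    toℕ k ℕ.+ ℓ ∸ toℕ i ℕ.+ toℕ i      ≡⟨ ℕₚ.m∸n+n≡m (ℕₚ.≤-trans (Finₚ.toℕ≤n i) (ℕₚ.m≤n+m ℓ (toℕ k))) ⟩
    toℕ k ℕ.+ ℓ                        ≈⟨ +ℓ≡ₘ (toℕ k) ⟩
    toℕ k                              ∎
    where open SetoidReasoning ≡ₘ-setoid

  toℕ-+ᶠ : ∀ i j → toℕ (i +ᶠ j) ≡ₘ toℕ i ℕ.+ toℕ j
  toℕ-+ᶠ i j = toℕ-[] (toℕ i ℕ.+ toℕ j)

  -ᶠ-unique : ∀ {k i u} → toℕ u ℕ.+ toℕ i ≡ₘ toℕ k → u ≡ k -ᶠ i
  -ᶠ-unique {k} {i} {u} u+i≡k =
    toℕ-injectiveₘ (+-cancelʳ-≡ₘ _ _ (toℕ i) (≡ₘ-trans u+i≡k (≡ₘ-sym (toℕ-ᶠ k i))))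

  -ᶠ-involutive : ∀ k i → k -ᶠ (k -ᶠ i) ≡ i
  -ᶠ-involutive k i = sym (-ᶠ-unique (≡ₘ-trans (≡⇒≡ₘ (ℕₚ.+-comm (toℕ i) _)) (toℕ-ᶠ k i)))

  neg-involutive : ∀ i → neg (neg i) ≡ i
  neg-involutive = -ᶠ-involutive fzero

  neg-injective : ∀ {i j} → neg i ≡ neg j → i ≡ j
  neg-injective {i} {j} eq = trans (sym (neg-involutive i)) (trans (cong neg eq) (neg-involutive j))

  -ᶠ-identityʳ : ∀ k → k -ᶠ fzero ≡ k
  -ᶠ-identityʳ k = toℕ-injectiveₘ (≡ₘ-trans (≡⇒≡ₘ (sym (ℕₚ.+-identityʳ _))) (toℕ-ᶠ k fzero))

  i+ᶠj-ᶠj≡i : ∀ i j → (i +ᶠ j) -ᶠ j ≡ i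
  i+ᶠj-ᶠj≡i i j = sym (-ᶠ-unique (≡ₘ-sym (toℕ-+ᶠ i j)))

  i-ᶠj+ᶠj≡i : ∀ i j → (i -ᶠ j) +ᶠ j ≡ i
  i-ᶠj+ᶠj≡i i j = toℕ-injectiveₘ (≡ₘ-trans (toℕ-+ᶠ (i -ᶠ j) j) (toℕ-ᶠ i j))

  k-ᶠ[i+ᶠj]≡k-ᶠj-ᶠi : ∀ k i j → k -ᶠ (i +ᶠ j) ≡ (k -ᶠ j) -ᶠ i
  k-ᶠ[i+ᶠj]≡k-ᶠj-ᶠi k i j = sym (-ᶠ-unique (begin
    toℕ u ℕ.+ toℕ (i +ᶠ j)                 ≈⟨ +-congₘ (≡ₘ-refl {toℕ u}) (toℕ-+ᶠ i j) ⟩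
    toℕ u ℕ.+ (toℕ i ℕ.+ toℕ j)            ≡⟨ sym (ℕₚ.+-assoc (toℕ u) (toℕ i) (toℕ j)) ⟩
    toℕ u ℕ.+ toℕ i ℕ.+ toℕ j              ≈⟨ +-congₘ (toℕ-ᶠ (k -ᶠ j) i) ≡ₘ-refl ⟩
    toℕ (k -ᶠ j) ℕ.+ toℕ j                 ≈⟨ toℕ-ᶠ k j ⟩
    toℕ k                                  ∎))
    where
    open SetoidReasoning ≡ₘ-setoid
    u = (k -ᶠ j) -ᶠ i

  neg-distrib-ᶠ : ∀ k i → neg (k -ᶠ neg i) ≡ neg k -ᶠ i
  neg-distrib-ᶠ k i = toℕ-injectiveₘ (+-cancelʳ-≡ₘ _ _ (toℕ i ℕ.+ toℕ k) (≡ₘ-trans lhs≡0 (≡ₘ-sym rhs≡0)))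
    where
    open SetoidReasoning ≡ₘ-setoid
    u = neg (k -ᶠ neg i)
    s = k -ᶠ neg i
    n = neg i
    rearrange : ∀ u i s n → u ℕ.+ (i ℕ.+ (s ℕ.+ n)) ≡ (u ℕ.+ s) ℕ.+ (n ℕ.+ i)
    rearrange = solve-∀
    lhs≡0 : toℕ u ℕ.+ (toℕ i ℕ.+ toℕ k) ≡ₘ 0
    lhs≡0 = begin
      toℕ u ℕ.+ (toℕ i ℕ.+ toℕ k)
        ≈⟨ +-congₘ (≡ₘ-refl {toℕ u}) (+-congₘ (≡ₘ-refl {toℕ i}) (≡ₘ-sym (toℕ-ᶠ k n))) ⟩
      toℕ u ℕ.+ (toℕ i ℕ.+ (toℕ s ℕ.+ toℕ n))
        ≡⟨ rearrange (toℕ u) (toℕ i) (toℕ s) (toℕ n) ⟩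
      (toℕ u ℕ.+ toℕ s) ℕ.+ (toℕ n ℕ.+ toℕ i)
        ≈⟨ +-congₘ (toℕ-ᶠ fzero s) (toℕ-ᶠ fzero i) ⟩
      0 ∎
    rhs≡0 : toℕ (neg k -ᶠ i) ℕ.+ (toℕ i ℕ.+ toℕ k) ≡ₘ 0
    rhs≡0 = begin
      toℕ (neg k -ᶠ i) ℕ.+ (toℕ i ℕ.+ toℕ k)          ≡⟨ sym (ℕₚ.+-assoc (toℕ (neg k -ᶠ i)) (toℕ i) (toℕ k)) ⟩
      toℕ (neg k -ᶠ i) ℕ.+ toℕ i ℕ.+ toℕ k            ≈⟨ +-congₘ (toℕ-ᶠ (neg k) i) ≡ₘ-refl ⟩
      toℕ (neg k) ℕ.+ toℕ k                             ≈⟨ toℕ-ᶠ fzero k ⟩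
      0                                                ∎

  -- The group ring ℚ[C_ℓ]

  GR : Set
  GR = D.GR ℓ

  infixl 6 _⊕_
  infixl 7 _⊛_ _·_
  _⊕_ _⊛_ : GR → GR → GR
  _⊕_ = D._⊕_ ℓ
  _⊛_ = D._⊛_ ℓ

  _·_ : ℚ → GR → GR
  _·_ = D._·_ ℓ

  mono : ℕ → GR
  mono = D.mono ℓ

  one : GR
  one = D.one ℓ

  conj : GR → GR
  conj = D.conj ℓ

  infix 4 _≐_
  _≐_ : GR → GR → Set
  a ≐ b = ∀ j → a j ≡ b j

  mono-hit : ∀ a j → j ≡ [ a ] → mono a j ≡ 1ℚ
  mono-hit a j j≡a with j Fin.≟ [ a ]
  ... | yes _   = refl
  ... | no  j≢a = ⊥-elim (j≢a j≡a)

  mono-miss : ∀ a j → j ≢ [ a ] → mono a j ≡ 0ℚ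
  mono-miss a j j≢a with j Fin.≟ [ a ]
  ... | yes j≡a = ⊥-elim (j≢a j≡a)
  ... | no  _   = refl

  mono-cong : ∀ {a b} → a ≡ₘ b → mono a ≐ mono b
  mono-cong {a} {b} a≡b j with j Fin.≟ [ a ] | j Fin.≟ [ b ]
  ... | yes _   | yes _   = refl
  ... | no  _   | no  _   = refl
  ... | yes j≡a | no  j≢b = ⊥-elim (j≢b (trans j≡a ([]-cong a≡b)))
  ... | no  j≢a | yes j≡b = ⊥-elim (j≢a (trans j≡b ([]-cong (≡ₘ-sym a≡b))))

  ⊛-comm : ∀ a b → a ⊛ b ≐ b ⊛ a
  ⊛-comm a b k = begin
    ∑ (λ i → a i ℚ.* b (k -ᶠ i))
      ≡⟨ sym (∑-reindex (λ i → a i ℚ.* b (k -ᶠ i)) (k -ᶠ_) (k -ᶠ_) (-ᶠ-involutive k) (-ᶠ-involutive k)) ⟩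
    ∑ (λ i → a (k -ᶠ i) ℚ.* b (k -ᶠ (k -ᶠ i)))
      ≡⟨ ∑-cong (λ i → trans (cong (λ t → a (k -ᶠ i) ℚ.* b t) (-ᶠ-involutive k i))
                             (ℚₚ.*-comm (a (k -ᶠ i)) (b i))) ⟩
    ∑ (λ i → b i ℚ.* a (k -ᶠ i)) ∎
    where open ≡-Reasoning

  ⊛-assoc : ∀ a b c → (a ⊛ b) ⊛ c ≐ a ⊛ (b ⊛ c)
  ⊛-assoc a b c k = begin
    ∑ (λ i → ∑ (λ j → a j ℚ.* b (i -ᶠ j)) ℚ.* c (k -ᶠ i))
      ≡⟨ ∑-cong (λ i → sym (∑-*ʳ (c (k -ᶠ i)) (λ j → a j ℚ.* b (i -ᶠ j)))) ⟩
    ∑ (λ i → ∑ (λ j → a j ℚ.* b (i -ᶠ j) ℚ.* c (k -ᶠ i)))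
      ≡⟨ ∑-comm (λ i j → a j ℚ.* b (i -ᶠ j) ℚ.* c (k -ᶠ i)) ⟩
    ∑ (λ j → ∑ (λ i → a j ℚ.* b (i -ᶠ j) ℚ.* c (k -ᶠ i)))
      ≡⟨ ∑-cong (λ j → trans (∑-cong (λ i → ℚₚ.*-assoc (a j) (b (i -ᶠ j)) (c (k -ᶠ i))))
                             (∑-*ˡ (a j) (λ i → b (i -ᶠ j) ℚ.* c (k -ᶠ i)))) ⟩
    ∑ (λ j → a j ℚ.* ∑ (λ i → b (i -ᶠ j) ℚ.* c (k -ᶠ i)))
      ≡⟨ ∑-cong (λ j → cong (a j ℚ.*_) (shift j)) ⟩
    ∑ (λ j → a j ℚ.* ∑ (λ i → b i ℚ.* c ((k -ᶠ j) -ᶠ i))) ∎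
    where
    open ≡-Reasoning
    shift : ∀ j → ∑ (λ i → b (i -ᶠ j) ℚ.* c (k -ᶠ i)) ≡ ∑ (λ i → b i ℚ.* c ((k -ᶠ j) -ᶠ i))
    shift j = sym (trans
      (∑-cong (λ i → cong₂ (λ x y → b x ℚ.* c y) (sym (i+ᶠj-ᶠj≡i i j)) (sym (k-ᶠ[i+ᶠj]≡k-ᶠj-ᶠi k i j))))
      (∑-reindex (λ i → b (i -ᶠ j) ℚ.* c (k -ᶠ i)) (_+ᶠ j) (_-ᶠ j)
                 (λ i → i-ᶠj+ᶠj≡i i j) (λ i → i+ᶠj-ᶠj≡i i j)))

  ·-⊛ : ∀ q a b → (q · a) ⊛ b ≐ q · (a ⊛ b)
  ·-⊛ q a b k = trans (∑-cong (λ i → ℚₚ.*-assoc q (a i) (b (k -ᶠ i)))) (∑-*ˡ q (λ i → a i ℚ.* b (k -ᶠ i)))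

  ⊛-identityˡ : ∀ a → one ⊛ a ≐ a
  ⊛-identityˡ a k =
    trans (∑-indicator (mono 0) (λ i → a (k -ᶠ i)) fzero (mono-hit 0 fzero refl) (mono-miss 0))
          (cong a (-ᶠ-identityʳ k))

  const : ℚ → GR
  const q = q · one

  const-⊛ : ∀ q a → const q ⊛ a ≐ q · a
  const-⊛ q a k = trans (·-⊛ q one a k) (cong (q ℚ.*_) (⊛-identityˡ a k))

  const1-⊛ : ∀ a → const 1ℚ ⊛ a ≐ a
  const1-⊛ a k = trans (const-⊛ 1ℚ a k) (ℚₚ.*-identityˡ (a k))

  ⊛-distribˡ-⊕ : ∀ a b c → a ⊛ (b ⊕ c) ≐ a ⊛ b ⊕ a ⊛ c
  ⊛-distribˡ-⊕ a b c k =
    trans (∑-cong (λ i → ℚₚ.*-distribˡ-+ (a i) (b (k -ᶠ i)) (c (k -ᶠ i))))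
          (∑-distrib-+ (λ i → a i ℚ.* b (k -ᶠ i)) (λ i → a i ℚ.* c (k -ᶠ i)))

  ⊛-cong : ∀ {a a′ b b′} → a ≐ a′ → b ≐ b′ → a ⊛ b ≐ a′ ⊛ b′
  ⊛-cong a≐a′ b≐b′ k = ∑-cong (λ i → cong₂ ℚ._*_ (a≐a′ i) (b≐b′ (k -ᶠ i)))

  mono-⊛ : ∀ a b → mono a ⊛ mono b ≐ mono (a ℕ.+ b)
  mono-⊛ a b k =
    trans (∑-indicator (mono a) (λ i → mono b (k -ᶠ i)) [ a ] (mono-hit a [ a ] refl) (mono-miss a))
          (shifted (k Fin.≟ [ a ℕ.+ b ]))
    where
    b+a≡a+b : toℕ [ b ] ℕ.+ toℕ [ a ] ≡ₘ toℕ [ a ℕ.+ b ]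
    b+a≡a+b = ≡ₘ-trans (+-congₘ (toℕ-[] b) (toℕ-[] a))
                (≡ₘ-trans (≡⇒≡ₘ (ℕₚ.+-comm b a)) (≡ₘ-sym (toℕ-[] (a ℕ.+ b))))
    shifted : Dec (k ≡ [ a ℕ.+ b ]) → mono b (k -ᶠ [ a ]) ≡ mono (a ℕ.+ b) k
    shifted (yes k≡a+b) =
      trans (mono-hit b _ (sym (-ᶠ-unique (≡ₘ-trans b+a≡a+b (≡⇒≡ₘ (cong toℕ (sym k≡a+b)))))))
            (sym (mono-hit (a ℕ.+ b) k k≡a+b))
    shifted (no k≢a+b) =
      trans (mono-miss b _ (λ k-a≡b → k≢a+b (toℕ-injectiveₘ (≡ₘ-trans (≡ₘ-sym (toℕ-ᶠ k [ a ]))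
                             (≡ₘ-trans (≡⇒≡ₘ (cong (λ t → toℕ t ℕ.+ toℕ [ a ]) k-a≡b)) b+a≡a+b)))))
            (sym (mono-miss (a ℕ.+ b) k k≢a+b))

  conj-mono : ∀ a b → a ℕ.+ b ≡ₘ 0 → conj (mono a) ≐ mono b
  conj-mono a b a+b≡0 j = compare (j Fin.≟ [ b ])
    where
    a≡-b : [ a ] ≡ neg [ b ]
    a≡-b = -ᶠ-unique (≡ₘ-trans (+-congₘ (toℕ-[] a) (toℕ-[] b)) a+b≡0)
    compare : Dec (j ≡ [ b ]) → mono a (neg j) ≡ mono b j
    compare (yes j≡b) = trans (mono-hit a (neg j) (trans (cong neg j≡b) (sym a≡-b))) (sym (mono-hit b j j≡b))
    compare (no j≢b)  = trans (mono-miss a (neg j) (λ -j≡a → j≢b (neg-injective (trans -j≡a a≡-b))))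
                              (sym (mono-miss b j j≢b))

  conj-⊛ : ∀ a b → conj (a ⊛ b) ≐ conj a ⊛ conj b
  conj-⊛ a b k = sym (begin
    ∑ (λ i → a (neg i) ℚ.* b (neg (k -ᶠ i)))
      ≡⟨ sym (∑-reindex (λ i → a (neg i) ℚ.* b (neg (k -ᶠ i))) neg neg neg-involutive neg-involutive) ⟩
    ∑ (λ i → a (neg (neg i)) ℚ.* b (neg (k -ᶠ (neg i))))
      ≡⟨ ∑-cong (λ i → cong₂ (λ x y → a x ℚ.* b y) (neg-involutive i) (neg-distrib-ᶠ k i)) ⟩
    ∑ (λ i → a i ℚ.* b (neg k -ᶠ i)) ∎)
    where open ≡-Reasoning

  conj-involutive : ∀ a → conj (conj a) ≐ a
  conj-involutive a j = cong a (neg-involutive j)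

  -- The cyclotomic field ℚ(ζ_ℓ)

  ⊝_ : GR → GR
  (⊝ a) j = ℚ.- a j

  𝟘 : GR
  𝟘 _ = 0ℚ

  -- ℚ(ζ_ℓ) is ℚ[C_ℓ] modulo the ideal ℚ·(1 + x + ⋯ + x^{ℓ-1}) of constant coefficient functions.
  infix 4 _≈_
  record _≈_ (a b : GR) : Set where
    constructor offset-by
    field
      offset  : ℚ
      shifted : ∀ j → a j ≡ b j ℚ.+ offset

  ≐⇒≈ : ∀ {a b} → a ≐ b → a ≈ b
  ≐⇒≈ a≐b = offset-by 0ℚ (λ j → trans (a≐b j) (sym (ℚₚ.+-identityʳ _)))

  ≈-isEquivalence : IsEquivalence _≈_
  ≈-isEquivalence = record
    { refl  = ≐⇒≈ (λ _ → refl)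
    ; sym   = λ {a} {b} (offset-by c a≡b+c) → offset-by (ℚ.- c) (λ j → begin
                b j                         ≡⟨ cancel (b j) c ⟨
                (b j ℚ.+ c) ℚ.+ ℚ.- c       ≡⟨ cong (ℚ._+ ℚ.- c) (a≡b+c j) ⟨
                a j ℚ.+ ℚ.- c               ∎)
    ; trans = λ {a} {b} {e} (offset-by c a≡b+c) (offset-by d b≡e+d) → offset-by (c ℚ.+ d) (λ j → begin
                a j                         ≡⟨ a≡b+c j ⟩
                b j ℚ.+ c                   ≡⟨ cong (ℚ._+ c) (b≡e+d j) ⟩
                (e j ℚ.+ d) ℚ.+ c           ≡⟨ swap (e j) d c ⟩
                e j ℚ.+ (c ℚ.+ d)           ∎)
    }
    where
    open ≡-Reasoning
    open +-*-Solver
    cancel : ∀ x c → (x ℚ.+ c) ℚ.+ ℚ.- c ≡ x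
    cancel = solve 2 (λ x c → (x :+ c) :+ (:- c) := x) refl
    swap : ∀ x d c → (x ℚ.+ d) ℚ.+ c ≡ x ℚ.+ (c ℚ.+ d)
    swap = solve 3 (λ x d c → (x :+ d) :+ c := x :+ (c :+ d)) refl

  ≈-setoid : Setoid _ _
  ≈-setoid = record { isEquivalence = ≈-isEquivalence }

  ⊕-cong : ∀ {a a′ b b′} → a ≈ a′ → b ≈ b′ → a ⊕ b ≈ a′ ⊕ b′
  ⊕-cong {a′ = a′} {b′ = b′} (offset-by c a≡a′+c) (offset-by d b≡b′+d) =
    offset-by (c ℚ.+ d) (λ j → trans (cong₂ ℚ._+_ (a≡a′+c j) (b≡b′+d j)) (interchange (a′ j) c (b′ j) d))
    where
    open +-*-Solver
    interchange : ∀ x c y d → (x ℚ.+ c) ℚ.+ (y ℚ.+ d) ≡ (x ℚ.+ y) ℚ.+ (c ℚ.+ d)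
    interchange = solve 4 (λ x c y d → (x :+ c) :+ (y :+ d) := (x :+ y) :+ (c :+ d)) refl

  ⊝-cong : ∀ {a a′} → a ≈ a′ → ⊝ a ≈ ⊝ a′
  ⊝-cong {a′ = a′} (offset-by c a≡a′+c) =
    offset-by (ℚ.- c) (λ j → trans (cong ℚ.-_ (a≡a′+c j)) (ℚₚ.neg-distrib-+ (a′ j) c))

  ⊛-congʳ : ∀ {a a′} b → a ≈ a′ → a ⊛ b ≈ a′ ⊛ b
  ⊛-congʳ {a} {a′} b (offset-by c a≡a′+c) = offset-by (c ℚ.* ∑ b) (λ k → begin
    ∑ (λ i → a i ℚ.* b (k -ᶠ i))
      ≡⟨ ∑-cong (λ i → trans (cong (ℚ._* b (k -ᶠ i)) (a≡a′+c i)) (ℚₚ.*-distribʳ-+ (b (k -ᶠ i)) (a′ i) c)) ⟩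
    ∑ (λ i → a′ i ℚ.* b (k -ᶠ i) ℚ.+ c ℚ.* b (k -ᶠ i))
      ≡⟨ ∑-distrib-+ (λ i → a′ i ℚ.* b (k -ᶠ i)) (λ i → c ℚ.* b (k -ᶠ i)) ⟩
    (a′ ⊛ b) k ℚ.+ ∑ (λ i → c ℚ.* b (k -ᶠ i))
      ≡⟨ cong ((a′ ⊛ b) k ℚ.+_) (∑-*ˡ c (λ i → b (k -ᶠ i))) ⟩
    (a′ ⊛ b) k ℚ.+ c ℚ.* ∑ (λ i → b (k -ᶠ i))
      ≡⟨ cong (λ t → (a′ ⊛ b) k ℚ.+ c ℚ.* t) (∑-reindex b (k -ᶠ_) (k -ᶠ_) (-ᶠ-involutive k) (-ᶠ-involutive k)) ⟩
    (a′ ⊛ b) k ℚ.+ c ℚ.* ∑ b ∎)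
    where open ≡-Reasoning

  ⊛-cong≈ : ∀ {a a′ b b′} → a ≈ a′ → b ≈ b′ → a ⊛ b ≈ a′ ⊛ b′
  ⊛-cong≈ {a} {a′} {b} {b′} a≈a′ b≈b′ = begin
    a ⊛ b      ≈⟨ ⊛-congʳ b a≈a′ ⟩
    a′ ⊛ b     ≈⟨ ≐⇒≈ (⊛-comm a′ b) ⟩
    b ⊛ a′     ≈⟨ ⊛-congʳ a′ b≈b′ ⟩
    b′ ⊛ a′    ≈⟨ ≐⇒≈ (⊛-comm b′ a′) ⟩
    a′ ⊛ b′    ∎
    where open SetoidReasoning ≈-setoid

  -- 1# is const 1ℚ rather than one, so that the solver's constant ι (+ 1) is 1# by computation.
  ℚζ : CommutativeRing _ _
  ℚζ = record
    { Carrier = GR ; _≈_ = _≈_ ; _+_ = _⊕_ ; _*_ = _⊛_ ; -_ = ⊝_ ; 0# = 𝟘 ; 1# = const 1ℚ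
    ; isCommutativeRing = record
      { isRing = record
        { +-isAbelianGroup = record
          { isGroup = record
            { isMonoid = record
              { isSemigroup = record
                { isMagma = record { isEquivalence = ≈-isEquivalence ; ∙-cong = ⊕-cong }
                ; assoc = λ a b c → ≐⇒≈ (λ j → ℚₚ.+-assoc (a j) (b j) (c j)) }
              ; identity = (λ a → ≐⇒≈ (λ j → ℚₚ.+-identityˡ (a j)))
                         , (λ a → ≐⇒≈ (λ j → ℚₚ.+-identityʳ (a j))) }
            ; inverse = (λ a → ≐⇒≈ (λ j → ℚₚ.+-inverseˡ (a j))) , (λ a → ≐⇒≈ (λ j → ℚₚ.+-inverseʳ (a j)))
            ; ⁻¹-cong = ⊝-cong }
          ; comm = λ a b → ≐⇒≈ (λ j → ℚₚ.+-comm (a j) (b j)) }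
        ; *-cong = ⊛-cong≈
        ; *-assoc = λ a b c → ≐⇒≈ (⊛-assoc a b c)
        ; *-identity = (λ a → ≐⇒≈ (const1-⊛ a))
                     , (λ a → ≐⇒≈ (λ k → trans (⊛-comm a (const 1ℚ) k) (const1-⊛ a k)))
        ; distrib = (λ a b c → ≐⇒≈ (⊛-distribˡ-⊕ a b c))
                  , (λ a b c → ≐⇒≈ (λ k → trans (⊛-comm (b ⊕ c) a k)
                                         (trans (⊛-distribˡ-⊕ a b c k) (cong₂ ℚ._+_ (⊛-comm a b k) (⊛-comm a c k))))) }
      ; *-comm = λ a b → ≐⇒≈ (⊛-comm a b) } }

  open CommutativeRing ℚζ public
    using ( _+_; _*_; -_; _-_; 0#; 1#; setoid; semiring; ring; commutativeSemiring; +-group; +-commutativeMonoid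
          ; +-cong; +-congˡ; +-congʳ; *-cong; *-congˡ; *-congʳ; *-comm; *-assoc; distribˡ
          ; *-identityˡ; *-identityʳ; +-identityˡ; +-identityʳ; -‿cong; -‿inverseʳ; zeroˡ; zeroʳ )
    renaming (refl to ≈-refl; sym to ≈-sym; trans to ≈-trans)
  open Exp semiring public using (_^_; ^-congˡ; ^-assocʳ)
  open CommutativeExp commutativeSemiring public using (^-distrib-*)
  open Mult semiring public using (×-congʳ; ×-assoc-*; ×-comm-*; ×-homo-1; ×-assocˡ) renaming (_×_ to _×ₙ_)
  module Binomial = CommutativeBinomial commutativeSemiring
  open RingProperties ring public using (x[y-z]≈xy-xz; -0#≈0#; -‿distribˡ-*; -‿distribʳ-*)
  open GroupProperties +-group public using () renaming (⁻¹-involutive to -‿involutive)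
  module ℚζΣ = CommutativeMonoidSum +-commutativeMonoid
  module ℚζΣ* = SemiringSum semiring

  sum-‿ : ∀ {n} (f : Fin n → GR) → ℚζΣ.sum (λ i → - f i) ≐ - ℚζΣ.sum f
  sum-‿ {zero}  f j = refl
  sum-‿ {suc n} f j = trans (cong (ℚ.- f fzero j ℚ.+_) (sum-‿ (f ∘ fsuc) j))
                            (sym (ℚₚ.neg-distrib-+ (f fzero j) (ℚζΣ.sum (f ∘ fsuc) j)))

  sum-distrib-difference : ∀ {n} (f g : Fin n → GR) → ℚζΣ.sum (λ i → f i - g i) ≈ ℚζΣ.sum f - ℚζΣ.sum g
  sum-distrib-difference f g = ≈-trans (ℚζΣ.∑-distrib-+ f (λ i → - g i)) (+-congˡ {ℚζΣ.sum f} (≐⇒≈ (sum-‿ g)))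

  sumℓ : (Fin ℓ → GR) → GR
  sumℓ = ℚζΣ.sum

  sumℓ-cong : ∀ {f g : Fin ℓ → GR} → (∀ i → f i ≈ g i) → sumℓ f ≈ sumℓ g
  sumℓ-cong = ℚζΣ.sum-cong-≋

  sumℓ-comm : ∀ (f : Fin ℓ → Fin ℓ → GR) → sumℓ (λ i → sumℓ (f i)) ≈ sumℓ (λ j → sumℓ (λ i → f i j))
  sumℓ-comm = ℚζΣ.∑-comm

  *-distribˡ-sumℓ : ∀ a (f : Fin ℓ → GR) → a * sumℓ f ≈ sumℓ (λ i → a * f i)
  *-distribˡ-sumℓ = ℚζΣ*.*-distribˡ-sum

  sum-pointwise : ∀ {n} (f : Fin n → GR) → ℚζΣ.sum f ≐ λ j → ∑ (λ i → f i j)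
  sum-pointwise {zero}  f j = refl
  sum-pointwise {suc n} f j = cong (f fzero j ℚ.+_) (sum-pointwise (f ∘ fsuc) j)

  ·≐const* : ∀ q a → q · a ≐ const q * a
  ·≐const* q a j = sym (const-⊛ q a j)

  const-+ : ∀ p q → const (p ℚ.+ q) ≐ const p + const q
  const-+ p q j = ℚₚ.*-distribʳ-+ (one j) p q

  const-* : ∀ p q → const (p ℚ.* q) ≈ const p * const q
  const-* p q = ≐⇒≈ (λ j → trans (ℚₚ.*-assoc p q (one j)) (·≐const* p (const q) j))

  ι : ℤ → GR
  ι z = const (ℤ→ℚ z)

  ι-homomorphism : ℤ-rawRing -Raw-AlmostCommutative⟶ fromCommutativeRing ℚζ
  ι-homomorphism = record
    { ⟦_⟧    = ι
    ; +-homo = λ a b → ≐⇒≈ (λ j → trans (cong (ℚ._* one j) (ℤ→ℚ-+ a b)) (const-+ (ℤ→ℚ a) (ℤ→ℚ b) j))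
    ; *-homo = λ a b → ≈-trans (≐⇒≈ (λ j → cong (ℚ._* one j) (ℤ→ℚ-* a b))) (const-* (ℤ→ℚ a) (ℤ→ℚ b))
    ; -‿homo = λ a → ≐⇒≈ (λ j → trans (cong (ℚ._* one j) (ℤ→ℚ-‿ a))
                                      (sym (ℚₚ.neg-distribˡ-* (ℤ→ℚ a) (one j))))
    ; 0-homo = ≐⇒≈ (λ j → ℚₚ.*-zeroˡ (one j))
    ; 1-homo = ≈-refl
    }

  ι-equal? : ∀ x y → Maybe (ι x ≈ ι y)
  ι-equal? x y with x ℤ.≟ y
  ... | yes refl = just ≈-refl
  ... | no  _    = nothing

  open RingSolver ℤ-rawRing (fromCommutativeRing ℚζ) ι-homomorphism ι-equal? public
    using (solve; _:+_; _:*_; :-_; _:-_; _:^_; _:=_; con)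

  tr : GR → ℚ
  tr = D.tr ℓ

  ∑-trMono≡0 : ∑ (D.trMono ℓ) ≡ 0ℚ
  ∑-trMono≡0 = begin
    ℕ→ℚ m ℚ.+ ∑ {m} (λ _ → ℚ.- 1ℚ)    ≡⟨ cong (ℕ→ℚ m ℚ.+_) (∑-const m (ℚ.- 1ℚ)) ⟩
    ℕ→ℚ m ℚ.+ ℕ→ℚ m ℚ.* ℚ.- 1ℚ        ≡⟨ cong (ℕ→ℚ m ℚ.+_) (ℚₚ.neg-distribʳ-* (ℕ→ℚ m) 1ℚ) ⟨
    ℕ→ℚ m ℚ.+ ℚ.- (ℕ→ℚ m ℚ.* 1ℚ)      ≡⟨ cong (λ x → ℕ→ℚ m ℚ.+ ℚ.- x) (ℚₚ.*-identityʳ (ℕ→ℚ m)) ⟩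
    ℕ→ℚ m ℚ.+ ℚ.- ℕ→ℚ m               ≡⟨ ℚₚ.+-inverseʳ (ℕ→ℚ m) ⟩
    0ℚ                                ∎
    where open ≡-Reasoning

  tr-cong : ∀ {a b} → a ≈ b → tr a ≡ tr b
  tr-cong {a} {b} (offset-by c a≡b+c) = begin
    ∑ (λ j → a j ℚ.* t j)
      ≡⟨ ∑-cong (λ j → trans (cong (ℚ._* t j) (a≡b+c j)) (ℚₚ.*-distribʳ-+ (t j) (b j) c)) ⟩
    ∑ (λ j → b j ℚ.* t j ℚ.+ c ℚ.* t j)
      ≡⟨ ∑-distrib-+ (λ j → b j ℚ.* t j) (λ j → c ℚ.* t j) ⟩
    tr b ℚ.+ ∑ (λ j → c ℚ.* t j)
      ≡⟨ cong (tr b ℚ.+_) (trans (∑-*ˡ c t) (trans (cong (c ℚ.*_) ∑-trMono≡0) (ℚₚ.*-zeroʳ c))) ⟩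
    tr b ℚ.+ 0ℚ
      ≡⟨ ℚₚ.+-identityʳ (tr b) ⟩
    tr b ∎
    where
    open ≡-Reasoning
    t = D.trMono ℓ

  conj-cong : ∀ {a b} → a ≈ b → conj a ≈ conj b
  conj-cong (offset-by c a≡b+c) = offset-by c (a≡b+c ∘ neg)

  conj-* : ∀ a b → conj (a * b) ≈ conj a * conj b
  conj-* a b = ≐⇒≈ (conj-⊛ a b)

  conj-one : conj one ≐ one
  conj-one = conj-mono 0 0 ≡ₘ-refl

  conj-const : ∀ q → conj (const q) ≐ const q
  conj-const q j = cong (q ℚ.*_) (conj-one j)

  conj-^ : ∀ a n → conj (a ^ n) ≈ conj a ^ n
  conj-^ a zero    = ≐⇒≈ (conj-const 1ℚ)
  conj-^ a (suc n) = ≈-trans (conj-* a (a ^ n)) (*-congˡ {conj a} (conj-^ a n))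

  conj-sum : ∀ {n} (f : Fin n → GR) → conj (ℚζΣ.sum f) ≐ ℚζΣ.sum (conj ∘ f)
  conj-sum {zero}  f j = refl
  conj-sum {suc n} f j = cong (conj (f fzero) j ℚ.+_) (conj-sum (f ∘ fsuc) j)

  scale : ℕ → Fin ℓ → Fin ℓ
  scale c i = [ c ℕ.* toℕ i ]

  scale-inverse : ∀ {c c′} → c ℕ.* c′ ≡ₘ 1 → ∀ i → scale c (scale c′ i) ≡ i
  scale-inverse {c} {c′} cc′≡1 i = toℕ-injectiveₘ (begin
    toℕ [ c ℕ.* toℕ [ c′ ℕ.* toℕ i ] ]   ≈⟨ toℕ-[] _ ⟩
    c ℕ.* toℕ [ c′ ℕ.* toℕ i ]           ≈⟨ *-congₘ (≡ₘ-refl {c}) (toℕ-[] _) ⟩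
    c ℕ.* (c′ ℕ.* toℕ i)                 ≡⟨ sym (ℕₚ.*-assoc c c′ (toℕ i)) ⟩
    c ℕ.* c′ ℕ.* toℕ i                   ≈⟨ *-congₘ cc′≡1 ≡ₘ-refl ⟩
    1 ℕ.* toℕ i                          ≡⟨ ℕₚ.*-identityˡ (toℕ i) ⟩
    toℕ i                                ∎)
    where open SetoidReasoning ≡ₘ-setoid

  ∑-indicator-mono : ∀ j → ∑ {ℓ} (λ i → mono (toℕ i) j) ≡ 1ℚ
  ∑-indicator-mono j =
    trans (∑-cong {ℓ} (λ i → sym (ℚₚ.*-identityʳ (mono (toℕ i) j))))
          (∑-indicator (λ i → mono (toℕ i) j) (λ _ → 1ℚ) j (mono-hit (toℕ j) j (sym ([]-toℕ j)))
                       (λ i i≢j → mono-miss (toℕ i) j (λ j≡i → i≢j (sym (trans j≡i ([]-toℕ i))))))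

  -- The sum over all ℓ-th roots of unity is 1 + x + ⋯ + x^{ℓ-1}, which vanishes in ℚ(ζ_ℓ).
  sum-mono-multiples≈0 : ∀ c {c′} → c ℕ.* c′ ≡ₘ 1 → sumℓ (λ b → mono (c ℕ.* toℕ b)) ≈ 0#
  sum-mono-multiples≈0 c {c′} cc′≡1 = offset-by 1ℚ (λ j → begin
    sumℓ f j                              ≡⟨ sum-pointwise f j ⟩
    ∑ (λ b → f b j)                       ≡⟨ ∑-cong {ℓ} (λ b → mono-cong (≡ₘ-sym (toℕ-[] (c ℕ.* toℕ b))) j) ⟩
    ∑ (λ b → mono (toℕ (scale c b)) j)    ≡⟨ ∑-reindex (λ i → mono (toℕ i) j) (scale c) (scale c′)
                                               (scale-inverse {c} {c′} cc′≡1) (scale-inverse {c′} {c} c′c≡1) ⟩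
    ∑ {ℓ} (λ i → mono (toℕ i) j)          ≡⟨ ∑-indicator-mono j ⟩
    1ℚ                                    ≡⟨ ℚₚ.+-identityˡ 1ℚ ⟨
    0ℚ ℚ.+ 1ℚ                             ∎)
    where
    open ≡-Reasoning
    f : Fin ℓ → GR
    f b = mono (c ℕ.* toℕ b)
    c′c≡1 : c′ ℕ.* c ≡ₘ 1
    c′c≡1 = ≡ₘ-trans (≡⇒≡ₘ (ℕₚ.*-comm c′ c)) cc′≡1

  ι-+ : ∀ a b → ι (a ℤ.+ b) ≈ ι a + ι b
  ι-+ = _-Raw-AlmostCommutative⟶_.+-homo ι-homomorphism

  ×ₙ1#≈ι : ∀ n → n ×ₙ 1# ≈ ι (+ n)
  ×ₙ1#≈ι zero    = ≐⇒≈ (λ j → sym (ℚₚ.*-zeroˡ (one j)))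
  ×ₙ1#≈ι (suc n) = ≈-trans (+-congˡ {1#} (×ₙ1#≈ι n)) (≈-sym (ι-+ (+ 1) (+ n)))

  ×ₙ≈ι* : ∀ n a → n ×ₙ a ≈ ι (+ n) * a
  ×ₙ≈ι* n a = begin
    n ×ₙ a            ≈⟨ ×-congʳ n (*-identityˡ a) ⟨
    n ×ₙ (1# * a)     ≈⟨ ×-assoc-* n 1# a ⟨
    (n ×ₙ 1#) * a     ≈⟨ *-congʳ {a} (×ₙ1#≈ι n) ⟩
    ι (+ n) * a      ∎
    where open SetoidReasoning setoid

  1/ℓ : ℚ
  1/ℓ = + 1 ℚ./ ℓ

  ι[ℓ]*const[1/ℓ]≈1 : ι (+ ℓ) * const 1/ℓ ≈ 1#
  ι[ℓ]*const[1/ℓ]≈1 =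
    ≈-trans (≈-sym (const-* (ℤ→ℚ (+ ℓ)) 1/ℓ)) (≐⇒≈ (λ j → cong (ℚ._* one j) ℓ*1/ℓ≡1))
    where
    ℓ*1/ℓ≡1 : ℤ→ℚ (+ ℓ) ℚ.* 1/ℓ ≡ 1ℚ
    ℓ*1/ℓ≡1 = trans (cong₂ ℚ._*_ (ℤ→ℚ≡mkℚ (+ ℓ)) (ℚₚ.↥p/↧p≡p (mkℚ (+ 1) m (1-coprimeTo _))))
                    (ℚₚ.*-inverseʳ (mkℚ (+ ℓ) 0 (Coprime.sym (1-coprimeTo _))))

  conj-1# : conj 1# ≐ 1#
  conj-1# = conj-const 1ℚ

  ^^≈^ : ∀ a n → D._^^_ ℓ a n ≈ a ^ n
  ^^≈^ a zero    = ≐⇒≈ (λ j → sym (ℚₚ.*-identityˡ (one j)))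
  ^^≈^ a (suc n) = *-congˡ {a} (^^≈^ a n)

  open CommutativeRingProperties ℚζ public

  geometric : GR → ℕ → GR
  geometric y zero    = 0#
  geometric y (suc n) = y ^ n + geometric y n

  geometric-sum : ∀ y n → (1# - y) * geometric y n ≈ 1# - y ^ n
  geometric-sum y zero    = ≈-trans (zeroʳ (1# - y)) (≈-sym (-‿inverseʳ 1#))
  geometric-sum y (suc n) = begin
    (1# - y) * (y ^ n + geometric y n)               ≈⟨ distribˡ (1# - y) (y ^ n) (geometric y n) ⟩
    (1# - y) * y ^ n + (1# - y) * geometric y n      ≈⟨ +-congˡ {(1# - y) * y ^ n} (geometric-sum y n) ⟩
    (1# - y) * y ^ n + (1# - y ^ n)                  ≈⟨ telescope y (y ^ n) ⟩
    1# - y * y ^ n                                   ∎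
    where
    open SetoidReasoning setoid
    telescope : ∀ y z → (1# - y) * z + (1# - z) ≈ 1# - y * z
    telescope = solve 2 (λ y z → (con (+ 1) :- y) :* z :+ (con (+ 1) :- z) := con (+ 1) :- y :* z) ≈-refl

  -- The lattice ℤ[ζ_ℓ]

  Integral : GR → Set
  Integral a = ∀ j → IsInteger (a j)

  integral-+ : ∀ {a b} → Integral a → Integral b → Integral (a + b)
  integral-+ a-int b-int j = isInteger-+ (a-int j) (b-int j)

  integral-‿ : ∀ {a} → Integral a → Integral (- a)
  integral-‿ a-int j = isInteger-‿ (a-int j)

  integral-* : ∀ {a b} → Integral a → Integral b → Integral (a * b)
  integral-* {a} {b} a-int b-int k =
    isInteger-∑ (λ i → a i ℚ.* b (k -ᶠ i)) (λ i → isInteger-* (a-int i) (b-int (k -ᶠ i)))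

  integral-mono : ∀ e → Integral (mono e)
  integral-mono e j with j Fin.≟ [ e ]
  ... | yes _ = + 1 , refl
  ... | no  _ = + 0 , refl

  integral-ι : ∀ z → Integral (ι z)
  integral-ι z j = isInteger-* (z , refl) (integral-mono 0 j)

  integral-^ : ∀ {a} → Integral a → ∀ n → Integral (a ^ n)
  integral-^ a-int zero    = integral-ι (+ 1)
  integral-^ a-int (suc n) = integral-* a-int (integral-^ a-int n)

  integral-0 : Integral 0#
  integral-0 _ = + 0 , refl

  integral-×ₙ : ∀ {a} → Integral a → ∀ n → Integral (n ×ₙ a)
  integral-×ₙ a-int zero    = integral-0
  integral-×ₙ a-int (suc n) = integral-+ a-int (integral-×ₙ a-int n)

  integral-sum : ∀ {n} (f : Fin n → GR) → (∀ i → Integral (f i)) → Integral (ℚζΣ.sum f)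
  integral-sum {zero}  f _     = integral-0
  integral-sum {suc n} f f-int = integral-+ (f-int fzero) (integral-sum (f ∘ fsuc) (f-int ∘ fsuc))

  emb : ℤζ ℓ → GR
  emb = D.emb ℓ

  integral-emb : ∀ v → Integral (emb v)
  integral-emb v j = isInteger-∑ _ (λ i → isInteger-* (lookup v i , refl) (integral-mono (toℕ i) j))

  []-inject₁ : ∀ (i : Fin m) → [ toℕ i ] ≡ Fin.inject₁ i
  []-inject₁ i = trans (cong [_] (sym (Finₚ.toℕ-inject₁ i))) ([]-toℕ (Fin.inject₁ i))

  emb-inject₁ : ∀ v i → emb v (Fin.inject₁ i) ≡ ℤ→ℚ (lookup v i)
  emb-inject₁ v i = trans (∑-cong (λ i′ → ℚₚ.*-comm (ℤ→ℚ (lookup v i′)) (mono (toℕ i′) (Fin.inject₁ i))))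
    (∑-indicator (λ i′ → mono (toℕ i′) (Fin.inject₁ i)) (λ i′ → ℤ→ℚ (lookup v i′)) i
       (mono-hit (toℕ i) (Fin.inject₁ i) (sym ([]-inject₁ i)))
       (λ i′ i′≢i → mono-miss (toℕ i′) (Fin.inject₁ i)
                      (λ i≡i′ → i′≢i (Finₚ.inject₁-injective (sym (trans i≡i′ ([]-inject₁ i′)))))))

  emb-fromℕ : ∀ v → emb v (Fin.fromℕ m) ≡ 0ℚ
  emb-fromℕ v = trans (∑-cong miss) (∑-zero m)
    where
    miss : ∀ i → ℤ→ℚ (lookup v i) ℚ.* mono (toℕ i) (Fin.fromℕ m) ≡ 0ℚ
    miss i = trans (cong (ℤ→ℚ (lookup v i) ℚ.*_)
                         (mono-miss (toℕ i) (Fin.fromℕ m) (λ eq → Finₚ.fromℕ≢inject₁ (trans eq ([]-inject₁ i)))))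
                   (ℚₚ.*-zeroʳ (ℤ→ℚ (lookup v i)))

  emb-+ : ∀ x y → emb (zipWith ℤ._+_ x y) ≐ emb x + emb y
  emb-+ x y j = trans (∑-cong term) (∑-distrib-+ (λ i → ℤ→ℚ (lookup x i) ℚ.* mono (toℕ i) j)
                                                  (λ i → ℤ→ℚ (lookup y i) ℚ.* mono (toℕ i) j))
    where
    term : ∀ i → ℤ→ℚ (lookup (zipWith ℤ._+_ x y) i) ℚ.* mono (toℕ i) j
               ≡ ℤ→ℚ (lookup x i) ℚ.* mono (toℕ i) j ℚ.+ ℤ→ℚ (lookup y i) ℚ.* mono (toℕ i) j
    term i = trans (cong (λ z → ℤ→ℚ z ℚ.* mono (toℕ i) j) (Vecₚ.lookup-zipWith ℤ._+_ i x y))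
                   (trans (cong (ℚ._* mono (toℕ i) j) (ℤ→ℚ-+ (lookup x i) (lookup y i)))
                          (ℚₚ.*-distribʳ-+ (mono (toℕ i) j) (ℤ→ℚ (lookup x i)) (ℤ→ℚ (lookup y i))))

  emb-* : ∀ c x → emb (Vec.map (c ℤ.*_) x) ≐ ℤ→ℚ c · emb x
  emb-* c x j = trans (∑-cong term) (∑-*ˡ (ℤ→ℚ c) (λ i → ℤ→ℚ (lookup x i) ℚ.* mono (toℕ i) j))
    where
    term : ∀ i → ℤ→ℚ (lookup (Vec.map (c ℤ.*_) x) i) ℚ.* mono (toℕ i) j
               ≡ ℤ→ℚ c ℚ.* (ℤ→ℚ (lookup x i) ℚ.* mono (toℕ i) j)
    term i = trans (cong (λ z → ℤ→ℚ z ℚ.* mono (toℕ i) j) (Vecₚ.lookup-map i (c ℤ.*_) x))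
                   (trans (cong (ℚ._* mono (toℕ i) j) (ℤ→ℚ-* c (lookup x i)))
                          (ℚₚ.*-assoc (ℤ→ℚ c) (ℤ→ℚ (lookup x i)) (mono (toℕ i) j)))

  emb-injective : ∀ {x y} → emb x ≈ emb y → x ≡ y
  emb-injective {x} {y} (offset-by c x≡y+c) = Pointwise-≡⇒≡ (ext (λ i → ℤ→ℚ-injective (begin
      ℤ→ℚ (lookup x i)                     ≡⟨ emb-inject₁ x i ⟨
      emb x (Fin.inject₁ i)                ≡⟨ x≡y+c (Fin.inject₁ i) ⟩
      emb y (Fin.inject₁ i) ℚ.+ c          ≡⟨ cong (emb y (Fin.inject₁ i) ℚ.+_) c≡0 ⟩
      emb y (Fin.inject₁ i) ℚ.+ 0ℚ         ≡⟨ ℚₚ.+-identityʳ _ ⟩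
      emb y (Fin.inject₁ i)                ≡⟨ emb-inject₁ y i ⟩
      ℤ→ℚ (lookup y i)                     ∎)))
    where
    open ≡-Reasoning
    c≡0 : c ≡ 0ℚ
    c≡0 = begin
      c                                    ≡⟨ ℚₚ.+-identityˡ c ⟨
      0ℚ ℚ.+ c                             ≡⟨ cong (ℚ._+ c) (emb-fromℕ y) ⟨
      emb y (Fin.fromℕ m) ℚ.+ c            ≡⟨ x≡y+c (Fin.fromℕ m) ⟨
      emb x (Fin.fromℕ m)                  ≡⟨ emb-fromℕ x ⟩
      0ℚ                                   ∎

  -- ζ^{ℓ-1} = -(1 + ζ + ⋯ + ζ^{ℓ-2}), so subtracting the top coefficient from all the others
  -- rewrites an element in the basis 1, ζ, …, ζ^{ℓ-2} of ℤ[ζ].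
  reduce : (Fin ℓ → ℤ) → ℤζ ℓ
  reduce c = tabulate (λ i → c (Fin.inject₁ i) ℤ.- c (Fin.fromℕ m))

  emb-reduce : ∀ c → emb (reduce c) ≈ ℤ→ℚ ∘ c
  emb-reduce c = offset-by (ℚ.- top) pointwise
    where
    top = ℤ→ℚ (c (Fin.fromℕ m))
    pointwise : ∀ j → emb (reduce c) j ≡ ℤ→ℚ (c j) ℚ.+ ℚ.- top
    pointwise j with Top.view j
    ... | Top.‵fromℕ = trans (emb-fromℕ (reduce c)) (sym (ℚₚ.+-inverseʳ top))
    ... | Top.‵inject₁ i = begin
      emb (reduce c) (Fin.inject₁ i)                          ≡⟨ emb-inject₁ (reduce c) i ⟩
      ℤ→ℚ (lookup (reduce c) i)                               ≡⟨ cong ℤ→ℚ (Vecₚ.lookup∘tabulate _ i) ⟩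
      ℤ→ℚ (c (Fin.inject₁ i) ℤ.- c (Fin.fromℕ m))             ≡⟨ ℤ→ℚ-+ (c (Fin.inject₁ i)) (ℤ.- c (Fin.fromℕ m)) ⟩
      ℤ→ℚ (c (Fin.inject₁ i)) ℚ.+ ℤ→ℚ (ℤ.- c (Fin.fromℕ m))
        ≡⟨ cong (ℤ→ℚ (c (Fin.inject₁ i)) ℚ.+_) (ℤ→ℚ-‿ (c (Fin.fromℕ m))) ⟩
      ℤ→ℚ (c (Fin.inject₁ i)) ℚ.+ ℚ.- top                     ∎
      where open ≡-Reasoning

  reduce-cong : ∀ {c d} → (∀ j → c j ≡ d j) → reduce c ≡ reduce d
  reduce-cong c≗d = Vecₚ.tabulate-cong (λ i → cong₂ ℤ._-_ (c≗d (Fin.inject₁ i)) (c≗d (Fin.fromℕ m)))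

  reduce-+ : ∀ c d → reduce (λ j → c j ℤ.+ d j) ≡ zipWith ℤ._+_ (reduce c) (reduce d)
  reduce-+ c d = Pointwise-≡⇒≡ (ext (λ i → begin
    lookup (reduce (λ j → c j ℤ.+ d j)) i                     ≡⟨ Vecₚ.lookup∘tabulate _ i ⟩
    (c (Fin.inject₁ i) ℤ.+ d (Fin.inject₁ i)) ℤ.- (c top ℤ.+ d top)
      ≡⟨ interchange (c (Fin.inject₁ i)) (d (Fin.inject₁ i)) (c top) (d top) ⟩
    (c (Fin.inject₁ i) ℤ.- c top) ℤ.+ (d (Fin.inject₁ i) ℤ.- d top)
      ≡⟨ cong₂ ℤ._+_ (Vecₚ.lookup∘tabulate _ i) (Vecₚ.lookup∘tabulate _ i) ⟨
    lookup (reduce c) i ℤ.+ lookup (reduce d) i               ≡⟨ Vecₚ.lookup-zipWith ℤ._+_ i (reduce c) (reduce d) ⟨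
    lookup (zipWith ℤ._+_ (reduce c) (reduce d)) i            ∎))
    where
    open ≡-Reasoning
    top = Fin.fromℕ m
    interchange : ∀ a b c d → (a ℤ.+ b) ℤ.- (c ℤ.+ d) ≡ (a ℤ.- c) ℤ.+ (b ℤ.- d)
    interchange = solveℤ-∀

  reduce-* : ∀ z c → reduce (λ j → z ℤ.* c j) ≡ Vec.map (z ℤ.*_) (reduce c)
  reduce-* z c = Pointwise-≡⇒≡ (ext (λ i → begin
    lookup (reduce (λ j → z ℤ.* c j)) i                       ≡⟨ Vecₚ.lookup∘tabulate _ i ⟩
    z ℤ.* c (Fin.inject₁ i) ℤ.- z ℤ.* c top                   ≡⟨ factor z (c (Fin.inject₁ i)) (c top) ⟩
    z ℤ.* (c (Fin.inject₁ i) ℤ.- c top)                       ≡⟨ cong (z ℤ.*_) (Vecₚ.lookup∘tabulate _ i) ⟨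
    z ℤ.* lookup (reduce c) i                                 ≡⟨ Vecₚ.lookup-map i (z ℤ.*_) (reduce c) ⟨
    lookup (Vec.map (z ℤ.*_) (reduce c)) i                    ∎))
    where
    open ≡-Reasoning
    top = Fin.fromℕ m
    factor : ∀ z a b → z ℤ.* a ℤ.- z ℤ.* b ≡ z ℤ.* (a ℤ.- b)
    factor = solveℤ-∀

  module MultiplicationBy (w : GR) (w-integral : Integral w) where

    coefficients : ℤζ ℓ → Fin ℓ → ℤ
    coefficients v j = proj₁ (integral-* w-integral (integral-emb v) j)

    coefficients-spec : ∀ v j → (w * emb v) j ≡ ℤ→ℚ (coefficients v j)
    coefficients-spec v j = proj₂ (integral-* w-integral (integral-emb v) j)

    coefficients-+ : ∀ x y j → coefficients (zipWith ℤ._+_ x y) j ≡ coefficients x j ℤ.+ coefficients y j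
    coefficients-+ x y j = ℤ→ℚ-injective (begin
      ℤ→ℚ (coefficients (zipWith ℤ._+_ x y) j)               ≡⟨ coefficients-spec (zipWith ℤ._+_ x y) j ⟨
      (w * emb (zipWith ℤ._+_ x y)) j                        ≡⟨ ⊛-cong {w} {w} (λ _ → refl) (emb-+ x y) j ⟩
      (w * (emb x + emb y)) j                                ≡⟨ ⊛-distribˡ-⊕ w (emb x) (emb y) j ⟩
      (w * emb x) j ℚ.+ (w * emb y) j                        ≡⟨ cong₂ ℚ._+_ (coefficients-spec x j) (coefficients-spec y j) ⟩
      ℤ→ℚ (coefficients x j) ℚ.+ ℤ→ℚ (coefficients y j)      ≡⟨ ℤ→ℚ-+ (coefficients x j) (coefficients y j) ⟨
      ℤ→ℚ (coefficients x j ℤ.+ coefficients y j)            ∎)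
      where open ≡-Reasoning

    coefficients-* : ∀ c x j → coefficients (Vec.map (c ℤ.*_) x) j ≡ c ℤ.* coefficients x j
    coefficients-* c x j = ℤ→ℚ-injective (begin
      ℤ→ℚ (coefficients (Vec.map (c ℤ.*_) x) j)              ≡⟨ coefficients-spec (Vec.map (c ℤ.*_) x) j ⟨
      (w * emb (Vec.map (c ℤ.*_) x)) j                       ≡⟨ ⊛-cong {w} {w} (λ _ → refl) (emb-* c x) j ⟩
      (w * (ℤ→ℚ c · emb x)) j                                ≡⟨ ⊛-comm w (ℤ→ℚ c · emb x) j ⟩
      ((ℤ→ℚ c · emb x) * w) j                                ≡⟨ ·-⊛ (ℤ→ℚ c) (emb x) w j ⟩
      ℤ→ℚ c ℚ.* (emb x * w) j                                ≡⟨ cong (ℤ→ℚ c ℚ.*_) (⊛-comm (emb x) w j) ⟩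
      ℤ→ℚ c ℚ.* (w * emb x) j                                ≡⟨ cong (ℤ→ℚ c ℚ.*_) (coefficients-spec x j) ⟩
      ℤ→ℚ c ℚ.* ℤ→ℚ (coefficients x j)                       ≡⟨ ℤ→ℚ-* c (coefficients x j) ⟨
      ℤ→ℚ (c ℤ.* coefficients x j)                           ∎)
      where open ≡-Reasoning

    mul : ℤζ ℓ → ℤζ ℓ
    mul v = reduce (coefficients v)

    emb-mul : ∀ v → emb (mul v) ≈ w * emb v
    emb-mul v = ≈-trans (emb-reduce (coefficients v)) (≐⇒≈ (λ j → sym (coefficients-spec v j)))

    mul-+ : ∀ x y → mul (zipWith ℤ._+_ x y) ≡ zipWith ℤ._+_ (mul x) (mul y)
    mul-+ x y = trans (reduce-cong (coefficients-+ x y)) (reduce-+ (coefficients x) (coefficients y))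

    mul-* : ∀ c x → mul (Vec.map (c ℤ.*_) x) ≡ Vec.map (c ℤ.*_) (mul x)
    mul-* c x = trans (reduce-cong (coefficients-* c x)) (reduce-* c (coefficients x))

    mul-preserves-form : ∀ {α δ} → δ * (w * conj w) ≈ α → ∀ x y → D.form ℓ δ (mul x) (mul y) ≡ D.form ℓ α x y
    mul-preserves-form {α} {δ} δww̄≈α x y = tr-cong (begin
      δ * (emb (mul x) * conj (emb (mul y)))             ≈⟨ *-congˡ {δ} (*-cong (emb-mul x) (conj-cong (emb-mul y))) ⟩
      δ * ((w * emb x) * conj (w * emb y))               ≈⟨ *-congˡ {δ} (*-congˡ {w * emb x} (conj-* w (emb y))) ⟩
      δ * ((w * emb x) * (conj w * conj (emb y)))        ≈⟨ regroup δ w (conj w) (emb x) (conj (emb y)) ⟩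
      (δ * (w * conj w)) * (emb x * conj (emb y))        ≈⟨ *-congʳ {emb x * conj (emb y)} δww̄≈α ⟩
      α * (emb x * conj (emb y))                         ∎)
      where
      open SetoidReasoning setoid
      regroup : ∀ d a b x y → d * ((a * x) * (b * y)) ≈ (d * (a * b)) * (x * y)
      regroup = solve 5 (λ d a b x y → d :* ((a :* x) :* (b :* y)) := (d :* (a :* b)) :* (x :* y)) ≈-refl

    mul-isLatticeMorphism : ∀ {α δ} → δ * (w * conj w) ≈ α → IsLatticeMorphism ℓ α δ mul
    mul-isLatticeMorphism {α} {δ} δww̄≈α = mul-+ , mul-* , mul-preserves-form {α} {δ} δww̄≈α

    mul-injective : Unit w → Injective ℓ mul
    mul-injective w-unit x y mulx≡muly = emb-injective (unit-cancelˡ {w} w-unit (begin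
      w * emb x                                          ≈⟨ emb-mul x ⟨
      emb (mul x)                                        ≡⟨ cong emb mulx≡muly ⟩
      emb (mul y)                                        ≈⟨ emb-mul y ⟩
      w * emb y                                          ∎))
      where open SetoidReasoning setoid

  module PrimitiveRoot (isPrime : Prime ℓ) (ℓ≢2 : ℓ ≢ 2) (k : ℕ) (ℓ∤k : ℓ ∤ k) where

    ζ : GR
    ζ = mono k

    ζ^[_] : ℕ → GR
    ζ^[ e ] = mono (k ℕ.* e)

    ζ^[]-cong : ∀ {e f} → e ≡ₘ f → ζ^[ e ] ≈ ζ^[ f ]
    ζ^[]-cong e≡f = ≐⇒≈ (mono-cong (*-congₘ (≡ₘ-refl {k}) e≡f))

    ζ^[]-+ : ∀ e f → ζ^[ e ] * ζ^[ f ] ≈ ζ^[ e ℕ.+ f ]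
    ζ^[]-+ e f = ≐⇒≈ (λ j → trans (mono-⊛ (k ℕ.* e) (k ℕ.* f) j)
                                  (mono-cong (≡⇒≡ₘ (sym (ℕₚ.*-distribˡ-+ k e f))) j))

    ζ^[0]≈1 : ζ^[ 0 ] ≈ 1#
    ζ^[0]≈1 = ≐⇒≈ (λ j → trans (mono-cong (≡⇒≡ₘ (ℕₚ.*-zeroʳ k)) j) (sym (ℚₚ.*-identityˡ (one j))))

    ζ≈ζ^[1] : ζ ≈ ζ^[ 1 ]
    ζ≈ζ^[1] = ≐⇒≈ (mono-cong (≡⇒≡ₘ (sym (ℕₚ.*-identityʳ k))))

    ζ^≈ζ^[] : ∀ e → ζ ^ e ≈ ζ^[ e ]
    ζ^≈ζ^[] zero    = ≈-sym ζ^[0]≈1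
    ζ^≈ζ^[] (suc e) = begin
      ζ * ζ ^ e          ≈⟨ *-cong ζ≈ζ^[1] (ζ^≈ζ^[] e) ⟩
      ζ^[ 1 ] * ζ^[ e ]  ≈⟨ ζ^[]-+ 1 e ⟩
      ζ^[ suc e ]        ∎
      where open SetoidReasoning setoid

    ζ^ℓ≈1 : ζ ^ ℓ ≈ 1#
    ζ^ℓ≈1 = ≈-trans (ζ^≈ζ^[] ℓ) (≈-trans (ζ^[]-cong ℓ≡ₘ0) ζ^[0]≈1)

    conj-ζ^[] : ∀ e → conj ζ^[ e ] ≈ ζ^[ m ℕ.* e ]
    conj-ζ^[] e =
      ≐⇒≈ (conj-mono (k ℕ.* e) (k ℕ.* (m ℕ.* e)) (≡ₘ-trans (≡⇒≡ₘ (factor k e m)) (*ℓ≡ₘ0 (k ℕ.* e))))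
      where
      factor : ∀ k e m → k ℕ.* e ℕ.+ k ℕ.* (m ℕ.* e) ≡ k ℕ.* e ℕ.* suc m
      factor = solve-∀

    ζ*conjζ≈1 : ζ * conj ζ ≈ 1#
    ζ*conjζ≈1 = begin
      ζ * conj ζ                ≈⟨ *-cong ζ≈ζ^[1] (≈-trans (conj-cong ζ≈ζ^[1]) (conj-ζ^[] 1)) ⟩
      ζ^[ 1 ] * ζ^[ m ℕ.* 1 ]   ≈⟨ ζ^[]-+ 1 (m ℕ.* 1) ⟩
      ζ^[ 1 ℕ.+ m ℕ.* 1 ]       ≈⟨ ζ^[]-cong (≡ₘ-trans (≡⇒≡ₘ (cong suc (ℕₚ.*-identityʳ m))) ℓ≡ₘ0) ⟩
      ζ^[ 0 ]                   ≈⟨ ζ^[0]≈1 ⟩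
      1#                        ∎
      where open SetoidReasoning setoid

    1-ζ*conjζ≈0 : 1# - ζ * conj ζ ≈ 0#
    1-ζ*conjζ≈0 = ≈-trans (+-congˡ {1#} (-‿cong ζ*conjζ≈1)) (-‿inverseʳ 1#)

    2∣m : 2 ∣ m
    2∣m = odd-prime⇒2∣pred isPrime ℓ≢2

    sum-ζ^[multiples]≈0 : ∀ {c} → ℓ ∤ c → sumℓ (λ b → ζ^[ c ℕ.* toℕ b ]) ≈ 0#
    sum-ζ^[multiples]≈0 {c} ℓ∤c =
      ≈-trans (sumℓ-cong (λ b → ≐⇒≈ (mono-cong (≡⇒≡ₘ (sym (ℕₚ.*-assoc k c (toℕ b)))))))
              (sum-mono-multiples≈0 (k ℕ.* c) (proj₂ (∤⇒invertibleₘ isPrime ℓ∤kc)))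
      where
      ℓ∤kc : ℓ ∤ k ℕ.* c
      ℓ∤kc ℓ∣kc with euclidsLemma k c isPrime ℓ∣kc
      ... | inj₁ ℓ∣k = ℓ∤k ℓ∣k
      ... | inj₂ ℓ∣c = ℓ∤c ℓ∣c

    1<ℓ : 1 ℕ.< ℓ
    1<ℓ = ℕ.nonTrivial⇒n>1 ℓ {{prime⇒nonTrivial isPrime}}

    2<ℓ : 2 ℕ.< ℓ
    2<ℓ = ℕₚ.≤∧≢⇒< 1<ℓ (ℓ≢2 ∘ sym)

    ℓ∤2[1+u] : ∀ (u : Fin m) → ℓ ∤ 2 ℕ.* suc (toℕ u)
    ℓ∤2[1+u] u ℓ∣2[1+u] with euclidsLemma 2 (suc (toℕ u)) isPrime ℓ∣2[1+u]
    ... | inj₁ ℓ∣2   = >⇒∤ 2<ℓ ℓ∣2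
    ... | inj₂ ℓ∣1+u = >⇒∤ (ℕ.s≤s (Finₚ.toℕ<n u)) ℓ∣1+u

    square : Fin ℓ → ℕ
    square a = toℕ a ℕ.* toℕ a

    gauss : GR
    gauss = sumℓ (λ a → ζ^[ square a ])

    conj-gauss : conj gauss ≈ sumℓ (λ a → ζ^[ m ℕ.* square a ])
    conj-gauss = ≈-trans (≐⇒≈ (conj-sum (λ a → ζ^[ square a ]))) (sumℓ-cong (λ a → conj-ζ^[] (square a)))

    -- m ≡ -1 (mod ℓ), so this is (u + b)² - b² = u² + 2ub.
    square-shift : ∀ u b → square (u +ᶠ b) ℕ.+ m ℕ.* square b ≡ₘ square u ℕ.+ 2 ℕ.* toℕ u ℕ.* toℕ b
    square-shift u b = begin
      square (u +ᶠ b) ℕ.+ m ℕ.* square b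
        ≈⟨ +-congₘ (*-congₘ (toℕ-+ᶠ u b) (toℕ-+ᶠ u b)) ≡ₘ-refl ⟩
      (toℕ u ℕ.+ toℕ b) ℕ.* (toℕ u ℕ.+ toℕ b) ℕ.+ m ℕ.* square b
        ≡⟨ expand (toℕ u) (toℕ b) m ⟩
      square u ℕ.+ 2 ℕ.* toℕ u ℕ.* toℕ b ℕ.+ square b ℕ.* ℓ
        ≈⟨ +-congₘ ≡ₘ-refl (*ℓ≡ₘ0 (square b)) ⟩
      square u ℕ.+ 2 ℕ.* toℕ u ℕ.* toℕ b ℕ.+ 0
        ≡⟨ ℕₚ.+-identityʳ _ ⟩
      square u ℕ.+ 2 ℕ.* toℕ u ℕ.* toℕ b ∎
      where
      open SetoidReasoning ≡ₘ-setoid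
      expand : ∀ u b m → (u ℕ.+ b) ℕ.* (u ℕ.+ b) ℕ.+ m ℕ.* (b ℕ.* b)
                         ≡ u ℕ.* u ℕ.+ 2 ℕ.* u ℕ.* b ℕ.+ b ℕ.* b ℕ.* suc m
      expand = solve-∀

    shift-inner-sum : ∀ b → sumℓ (λ a → ζ^[ square a ℕ.+ m ℕ.* square b ])
                            ≈ sumℓ (λ u → ζ^[ square u ] * ζ^[ 2 ℕ.* toℕ u ℕ.* toℕ b ])
    shift-inner-sum b = begin
      sumℓ (λ a → ζ^[ square a ℕ.+ m ℕ.* square b ])
        ≈⟨ ℚζΣ.∑-permute (λ a → ζ^[ square a ℕ.+ m ℕ.* square b ])
                         (permutation (_+ᶠ b) (_-ᶠ b) (λ a → i-ᶠj+ᶠj≡i a b) (λ u → i+ᶠj-ᶠj≡i u b)) ⟩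
      sumℓ (λ u → ζ^[ square (u +ᶠ b) ℕ.+ m ℕ.* square b ])
        ≈⟨ sumℓ-cong (λ u → ζ^[]-cong (square-shift u b)) ⟩
      sumℓ (λ u → ζ^[ square u ℕ.+ 2 ℕ.* toℕ u ℕ.* toℕ b ])
        ≈⟨ sumℓ-cong (λ u → ≈-sym (ζ^[]-+ (square u) (2 ℕ.* toℕ u ℕ.* toℕ b))) ⟩
      sumℓ (λ u → ζ^[ square u ] * ζ^[ 2 ℕ.* toℕ u ℕ.* toℕ b ]) ∎
      where open SetoidReasoning setoid

    gauss*conj-gauss≈double-sum :
      gauss * conj gauss ≈ sumℓ (λ u → ζ^[ square u ] * sumℓ (λ b → ζ^[ 2 ℕ.* toℕ u ℕ.* toℕ b ]))
    gauss*conj-gauss≈double-sum = begin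
      gauss * conj gauss
        ≈⟨ *-congˡ {gauss} conj-gauss ⟩
      gauss * sumℓ (λ b → ζ^[ m ℕ.* square b ])
        ≈⟨ ℚζΣ*.*-distribʳ-sum (sumℓ (λ b → ζ^[ m ℕ.* square b ])) (λ a → ζ^[ square a ]) ⟩
      sumℓ (λ a → ζ^[ square a ] * sumℓ (λ b → ζ^[ m ℕ.* square b ]))
        ≈⟨ sumℓ-cong (λ a → *-distribˡ-sumℓ (ζ^[ square a ]) (λ b → ζ^[ m ℕ.* square b ])) ⟩
      sumℓ (λ a → sumℓ (λ b → ζ^[ square a ] * ζ^[ m ℕ.* square b ]))
        ≈⟨ sumℓ-cong (λ a → sumℓ-cong (λ b → ζ^[]-+ (square a) (m ℕ.* square b))) ⟩
      sumℓ (λ a → sumℓ (λ b → ζ^[ square a ℕ.+ m ℕ.* square b ]))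
        ≈⟨ sumℓ-comm (λ a b → ζ^[ square a ℕ.+ m ℕ.* square b ]) ⟩
      sumℓ (λ b → sumℓ (λ a → ζ^[ square a ℕ.+ m ℕ.* square b ]))
        ≈⟨ sumℓ-cong shift-inner-sum ⟩
      sumℓ (λ b → sumℓ (λ u → ζ^[ square u ] * ζ^[ 2 ℕ.* toℕ u ℕ.* toℕ b ]))
        ≈⟨ sumℓ-comm (λ b u → ζ^[ square u ] * ζ^[ 2 ℕ.* toℕ u ℕ.* toℕ b ]) ⟩
      sumℓ (λ u → sumℓ (λ b → ζ^[ square u ] * ζ^[ 2 ℕ.* toℕ u ℕ.* toℕ b ]))
        ≈⟨ sumℓ-cong (λ u → ≈-sym (*-distribˡ-sumℓ (ζ^[ square u ]) (λ b → ζ^[ 2 ℕ.* toℕ u ℕ.* toℕ b ]))) ⟩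
      sumℓ (λ u → ζ^[ square u ] * sumℓ (λ b → ζ^[ 2 ℕ.* toℕ u ℕ.* toℕ b ])) ∎
      where open SetoidReasoning setoid

    gauss*conj-gauss≈ℓ : gauss * conj gauss ≈ ι (+ ℓ)
    gauss*conj-gauss≈ℓ = begin
      gauss * conj gauss
        ≈⟨ gauss*conj-gauss≈double-sum ⟩
      ζ^[ 0 ] * sumℓ (λ b → ζ^[ 0 ])
        + ℚζΣ.sum {m} (λ u → ζ^[ square (fsuc u) ] * sumℓ (λ b → ζ^[ 2 ℕ.* suc (toℕ u) ℕ.* toℕ b ]))
        ≈⟨ +-cong (*-cong ζ^[0]≈1 (sumℓ-cong (λ _ → ζ^[0]≈1))) (ℚζΣ.sum-cong-≋ {m} vanishing) ⟩
      1# * sumℓ (λ _ → 1#) + ℚζΣ.sum {m} (λ _ → 0#)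
        ≈⟨ +-cong (≈-trans (*-identityˡ (sumℓ (λ _ → 1#))) (ℚζΣ.sum-replicate ℓ {1#})) (ℚζΣ.sum-replicate-zero m) ⟩
      ℓ ×ₙ 1# + 0#
        ≈⟨ ≈-trans (+-identityʳ (ℓ ×ₙ 1#)) (×ₙ1#≈ι ℓ) ⟩
      ι (+ ℓ) ∎
      where
      open SetoidReasoning setoid
      vanishing : ∀ u → ζ^[ square (fsuc u) ] * sumℓ (λ b → ζ^[ 2 ℕ.* suc (toℕ u) ℕ.* toℕ b ]) ≈ 0#
      vanishing u = ≈-trans (*-congˡ {ζ^[ square (fsuc u) ]} (sum-ζ^[multiples]≈0 (ℓ∤2[1+u] u)))
                            (zeroʳ ζ^[ square (fsuc u) ])

    p : GR
    p = 1# - ζ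

    p*geometric : ∀ n → p * geometric ζ n ≈ 1# - ζ^[ n ]
    p*geometric n = ≈-trans (geometric-sum ζ n) (+-congˡ {1#} (-‿cong (ζ^≈ζ^[] n)))

    h : GR
    h = sumℓ (λ a → geometric ζ (toℕ a) - geometric ζ (m ℕ.* square a))

    p*h≈conj-gauss : p * h ≈ conj gauss
    p*h≈conj-gauss = begin
      p * h
        ≈⟨ *-distribˡ-sumℓ p (λ a → geometric ζ (toℕ a) - geometric ζ (m ℕ.* square a)) ⟩
      sumℓ (λ a → p * (geometric ζ (toℕ a) - geometric ζ (m ℕ.* square a)))
        ≈⟨ sumℓ-cong (λ a → telescope (toℕ a) (m ℕ.* square a)) ⟩
      sumℓ (λ a → ζ^[ m ℕ.* square a ] - ζ^[ 1 ℕ.* toℕ a ])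
        ≈⟨ sum-distrib-difference (λ a → ζ^[ m ℕ.* square a ]) (λ a → ζ^[ 1 ℕ.* toℕ a ]) ⟩
      sumℓ (λ a → ζ^[ m ℕ.* square a ]) - sumℓ (λ a → ζ^[ 1 ℕ.* toℕ a ])
        ≈⟨ +-cong (≈-sym conj-gauss) (-‿cong (sum-ζ^[multiples]≈0 (>⇒∤ 1<ℓ))) ⟩
      conj gauss - 0#
        ≈⟨ ≈-trans (+-congˡ {conj gauss} (≈-sym -0#≈0#)) (+-identityʳ (conj gauss)) ⟩
      conj gauss ∎
      where
      open SetoidReasoning setoid
      telescope : ∀ e f → p * (geometric ζ e - geometric ζ f) ≈ ζ^[ f ] - ζ^[ 1 ℕ.* e ]
      telescope e f = begin
        p * (geometric ζ e - geometric ζ f)                  ≈⟨ x[y-z]≈xy-xz p (geometric ζ e) (geometric ζ f) ⟩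
        p * geometric ζ e - p * geometric ζ f                ≈⟨ +-cong (p*geometric e) (-‿cong (p*geometric f)) ⟩
        (1# - ζ^[ e ]) - (1# - ζ^[ f ])                      ≈⟨ cancel ζ^[ e ] ζ^[ f ] ⟩
        ζ^[ f ] - ζ^[ e ]                                    ≈⟨ +-congˡ {ζ^[ f ]} (-‿cong (ζ^[]-cong (≡⇒≡ₘ (sym (ℕₚ.*-identityˡ e))))) ⟩
        ζ^[ f ] - ζ^[ 1 ℕ.* e ]                              ∎
        where
        cancel : ∀ x y → (1# - x) - (1# - y) ≈ y - x
        cancel = solve 2 (λ x y → (con (+ 1) :- x) :- (con (+ 1) :- y) := y :- x) ≈-refl

    L : GR
    L = const 1/ℓ

    [p*h]*[gauss*L]≈1 : (p * h) * (gauss * L) ≈ 1#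
    [p*h]*[gauss*L]≈1 = begin
      (p * h) * (gauss * L)       ≈⟨ *-congʳ {gauss * L} p*h≈conj-gauss ⟩
      conj gauss * (gauss * L)    ≈⟨ *-assoc (conj gauss) gauss L ⟨
      (conj gauss * gauss) * L    ≈⟨ *-congʳ {L} (≈-trans (*-comm (conj gauss) gauss) gauss*conj-gauss≈ℓ) ⟩
      ι (+ ℓ) * L                 ≈⟨ ι[ℓ]*const[1/ℓ]≈1 ⟩
      1#                          ∎
      where open SetoidReasoning setoid

    p-unit : Unit p
    p-unit = h * (gauss * L) , ≈-trans (≈-sym (*-assoc p h (gauss * L))) [p*h]*[gauss*L]≈1

    h-unit : Unit h
    h-unit = p * (gauss * L) , ≈-trans (≈-trans (≈-sym (*-assoc h p (gauss * L))) (*-congʳ {gauss * L} (*-comm h p)))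
                                      [p*h]*[gauss*L]≈1

    x : GR
    x = - p

    x+1≈ζ : x + 1# ≈ ζ
    x+1≈ζ = solve 1 (λ z → (:- (con (+ 1) :- z)) :+ con (+ 1) := z) ≈-refl ζ

    binomial-sum : GR
    binomial-sum = sumℓ (λ i → (ℓ C suc (toℕ i)) ×ₙ x ^ toℕ i)

    -- Binomial expansion of 1 = ζ^ℓ = (x + 1)^ℓ.
    1+x*binomial-sum≈1 : 1# + x * binomial-sum ≈ 1#
    1+x*binomial-sum≈1 = begin
      1# + x * binomial-sum
        ≈⟨ +-congˡ {1#} (*-distribˡ-sumℓ x (λ i → (ℓ C suc (toℕ i)) ×ₙ x ^ toℕ i)) ⟩
      1# + sumℓ (λ i → x * ((ℓ C suc (toℕ i)) ×ₙ x ^ toℕ i))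
        ≈⟨ +-cong (≈-sym first-term) (sumℓ-cong (≈-sym ∘ later-term)) ⟩
      Binomial.binomialExpansion x 1# ℓ
        ≈⟨ Binomial.theorem ℓ x 1# ⟨
      (x + 1#) ^ ℓ
        ≈⟨ ^-congˡ ℓ x+1≈ζ ⟩
      ζ ^ ℓ
        ≈⟨ ζ^ℓ≈1 ⟩
      1# ∎
      where
      open SetoidReasoning setoid
      first-term : Binomial.binomialTerm x 1# ℓ fzero ≈ 1#
      first-term = ≈-trans (+-identityʳ _) (≈-trans (*-identityˡ (1# ^ ℓ)) (1^n≈1 ℓ))
      later-term : ∀ i → Binomial.binomialTerm x 1# ℓ (fsuc i) ≈ x * ((ℓ C suc (toℕ i)) ×ₙ x ^ toℕ i)
      later-term i = begin
        (ℓ C suc (toℕ i)) ×ₙ (x ^ suc (toℕ i) * 1# ^ (ℓ ∸ suc (toℕ i)))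
          ≈⟨ ×-congʳ (ℓ C suc (toℕ i)) (*-congˡ {x ^ suc (toℕ i)} (1^n≈1 (ℓ ∸ suc (toℕ i)))) ⟩
        (ℓ C suc (toℕ i)) ×ₙ (x * x ^ toℕ i * 1#)
          ≈⟨ ×-congʳ (ℓ C suc (toℕ i)) (*-identityʳ (x ^ suc (toℕ i))) ⟩
        (ℓ C suc (toℕ i)) ×ₙ (x * x ^ toℕ i)
          ≈⟨ ×-comm-* (ℓ C suc (toℕ i)) x (x ^ toℕ i) ⟨
        x * ((ℓ C suc (toℕ i)) ×ₙ x ^ toℕ i) ∎

    binomial-sum≈0 : binomial-sum ≈ 0#
    binomial-sum≈0 = unit-cancelˡ {x} (unit-‿ {p} p-unit) (begin
      x * binomial-sum                          ≈⟨ plus-minus 1# (x * binomial-sum) ⟩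
      (1# + x * binomial-sum) - 1#              ≈⟨ +-congʳ { - 1#} 1+x*binomial-sum≈1 ⟩
      1# - 1#                                   ≈⟨ -‿inverseʳ 1# ⟩
      0#                                        ≈⟨ zeroʳ x ⟨
      x * 0#                                    ∎)
      where
      open SetoidReasoning setoid
      plus-minus : ∀ a b → b ≈ (a + b) - a
      plus-minus = solve 2 (λ a b → b := (a :+ b) :- a) ≈-refl

    q : Fin m → ℕ
    q i = (ℓ C suc (toℕ i)) ℕ./ ℓ

    ℓ*q≡C : ∀ i → ℓ ℕ.* q i ≡ ℓ C suc (toℕ i)
    ℓ*q≡C i = DivMod.m*[n/m]≡n (prime∣pC[1+k] isPrime (toℕ i) (Finₚ.toℕ<n i))

    T : GR
    T = ℚζΣ.sum {m} (λ i → q i ×ₙ x ^ toℕ i)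

    E : GR
    E = - T

    binomial-sum≈ℓT+x^m : binomial-sum ≈ ι (+ ℓ) * T + x ^ m
    binomial-sum≈ℓT+x^m = begin
      binomial-sum
        ≈⟨ ℚζΣ.sum-init-last {m} (λ i → (ℓ C suc (toℕ i)) ×ₙ x ^ toℕ i) ⟩
      ℚζΣ.sum {m} (λ i → (ℓ C suc (toℕ (Fin.inject₁ i))) ×ₙ x ^ toℕ (Fin.inject₁ i))
        + (ℓ C suc (toℕ (Fin.fromℕ m))) ×ₙ x ^ toℕ (Fin.fromℕ m)
        ≈⟨ +-cong (ℚζΣ.sum-cong-≋ {m} init-term) last-term ⟩
      ℚζΣ.sum {m} (λ i → ι (+ ℓ) * (q i ×ₙ x ^ toℕ i)) + x ^ m
        ≈⟨ +-congʳ {x ^ m} (ℚζΣ*.*-distribˡ-sum {m} (ι (+ ℓ)) (λ i → q i ×ₙ x ^ toℕ i)) ⟨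
      ι (+ ℓ) * T + x ^ m ∎
      where
      open SetoidReasoning setoid
      init-term : ∀ i → (ℓ C suc (toℕ (Fin.inject₁ i))) ×ₙ x ^ toℕ (Fin.inject₁ i) ≈ ι (+ ℓ) * (q i ×ₙ x ^ toℕ i)
      init-term i = begin
        (ℓ C suc (toℕ (Fin.inject₁ i))) ×ₙ x ^ toℕ (Fin.inject₁ i)  ≡⟨ cong (λ t → (ℓ C suc t) ×ₙ x ^ t) (Finₚ.toℕ-inject₁ i) ⟩
        (ℓ C suc (toℕ i)) ×ₙ x ^ toℕ i                              ≡⟨ cong (_×ₙ x ^ toℕ i) (ℓ*q≡C i) ⟨
        (ℓ ℕ.* q i) ×ₙ x ^ toℕ i                                    ≈⟨ ×-assocˡ (x ^ toℕ i) ℓ (q i) ⟨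
        ℓ ×ₙ (q i ×ₙ x ^ toℕ i)                                     ≈⟨ ×ₙ≈ι* ℓ (q i ×ₙ x ^ toℕ i) ⟩
        ι (+ ℓ) * (q i ×ₙ x ^ toℕ i)                                ∎
      last-term : (ℓ C suc (toℕ (Fin.fromℕ m))) ×ₙ x ^ toℕ (Fin.fromℕ m) ≈ x ^ m
      last-term = begin
        (ℓ C suc (toℕ (Fin.fromℕ m))) ×ₙ x ^ toℕ (Fin.fromℕ m)      ≡⟨ cong (λ t → (ℓ C suc t) ×ₙ x ^ t) (Finₚ.toℕ-fromℕ m) ⟩
        (ℓ C ℓ) ×ₙ x ^ m                                            ≡⟨ cong (_×ₙ x ^ m) (nCn≡1 ℓ) ⟩
        1 ×ₙ x ^ m                                                  ≈⟨ ×-homo-1 (x ^ m) ⟩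
        x ^ m                                                       ∎

    ℓE≈p^m : ι (+ ℓ) * E ≈ p ^ m
    ℓE≈p^m = begin
      ι (+ ℓ) * E                          ≈⟨ -‿distribʳ-* (ι (+ ℓ)) T ⟨
      - (ι (+ ℓ) * T)                      ≈⟨ +-identityˡ (- (ι (+ ℓ) * T)) ⟨
      0# - ι (+ ℓ) * T                     ≈⟨ +-congʳ { - (ι (+ ℓ) * T)} (≈-trans (≈-sym binomial-sum≈0) binomial-sum≈ℓT+x^m) ⟩
      (ι (+ ℓ) * T + x ^ m) - ι (+ ℓ) * T  ≈⟨ cancel (ι (+ ℓ) * T) (x ^ m) ⟩
      x ^ m                                ≈⟨ ^-neg-even p 2∣m ⟩
      p ^ m                                ∎
      where
      open SetoidReasoning setoid
      cancel : ∀ a b → (a + b) - a ≈ b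
      cancel = solve 2 (λ a b → (a :+ b) :- a := b) ≈-refl

    E-unit : Unit E
    E-unit = ι (+ ℓ) * p⁻ᵐ , (begin
      E * (ι (+ ℓ) * p⁻ᵐ)      ≈⟨ *-assoc E (ι (+ ℓ)) p⁻ᵐ ⟨
      (E * ι (+ ℓ)) * p⁻ᵐ      ≈⟨ *-congʳ {p⁻ᵐ} (≈-trans (*-comm E (ι (+ ℓ))) ℓE≈p^m) ⟩
      p ^ m * p⁻ᵐ              ≈⟨ proj₂ (unit-^ {p} p-unit m) ⟩
      1#                       ∎)
      where
      open SetoidReasoning setoid
      p⁻ᵐ = proj₁ (unit-^ {p} p-unit m)

    u : GR
    u = 1# + ζ

    [-ζ]^ℓ≈-1 : (- ζ) ^ ℓ ≈ - 1#
    [-ζ]^ℓ≈-1 = begin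
      (- ζ) * (- ζ) ^ m        ≈⟨ *-congˡ { - ζ} (^-neg-even ζ 2∣m) ⟩
      (- ζ) * ζ ^ m            ≈⟨ -‿distribˡ-* ζ (ζ ^ m) ⟨
      - (ζ ^ ℓ)                ≈⟨ -‿cong ζ^ℓ≈1 ⟩
      - 1#                     ∎
      where open SetoidReasoning setoid

    u*geometric[-ζ]≈2 : u * geometric (- ζ) ℓ ≈ ι (+ 2)
    u*geometric[-ζ]≈2 = begin
      u * geometric (- ζ) ℓ            ≈⟨ *-congʳ {geometric (- ζ) ℓ} (+-congˡ {1#} (-‿involutive ζ)) ⟨
      (1# - - ζ) * geometric (- ζ) ℓ   ≈⟨ geometric-sum (- ζ) ℓ ⟩
      1# - (- ζ) ^ ℓ                   ≈⟨ +-congˡ {1#} (-‿cong [-ζ]^ℓ≈-1) ⟩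
      1# - - 1#                        ≈⟨ solve 0 (con (+ 1) :- (:- con (+ 1)) := con (+ 2)) ≈-refl ⟩
      ι (+ 2)                          ∎
      where open SetoidReasoning setoid

    u-unit : Unit u
    u-unit = geometric (- ζ) ℓ * half , (begin
      u * (geometric (- ζ) ℓ * half)    ≈⟨ *-assoc u (geometric (- ζ) ℓ) half ⟨
      (u * geometric (- ζ) ℓ) * half    ≈⟨ *-congʳ {half} u*geometric[-ζ]≈2 ⟩
      ι (+ 2) * half                    ≈⟨ const-* (ℤ→ℚ (+ 2)) (+ 1 ℚ./ 2) ⟨
      1#                                ∎)
      where
      open SetoidReasoning setoid
      half = const (+ 1 ℚ./ 2)

    w : GR
    w = E * u ^ m * h

    w-unit : Unit w
    w-unit = unit-* {E * u ^ m} {h} (unit-* {E} {u ^ m} E-unit (unit-^ {u} u-unit m)) h-unit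

    w-integral : Integral w
    w-integral = integral-* {E * u ^ m} {h} (integral-* {E} {u ^ m} E-integral (integral-^ u-integral m)) h-integral
      where
      ζ-integral : Integral ζ
      ζ-integral = integral-mono k
      x-integral : Integral x
      x-integral = integral-‿ {p} (integral-+ {1#} { - ζ} (integral-ι (+ 1)) (integral-‿ {ζ} ζ-integral))
      E-integral : Integral E
      E-integral = integral-‿ {T} (integral-sum (λ i → q i ×ₙ x ^ toℕ i)
                                                 (λ i → integral-×ₙ (integral-^ x-integral (toℕ i)) (q i)))
      u-integral : Integral u
      u-integral = integral-+ {1#} {ζ} (integral-ι (+ 1)) ζ-integral
      geometric-integral : ∀ n → Integral (geometric ζ n)
      geometric-integral zero    = integral-0
      geometric-integral (suc n) = integral-+ {ζ ^ n} {geometric ζ n} (integral-^ ζ-integral n) (geometric-integral n)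
      h-integral : Integral h
      h-integral = integral-sum (λ a → geometric ζ (toℕ a) - geometric ζ (m ℕ.* square a))
        (λ a → integral-+ {geometric ζ (toℕ a)} (geometric-integral (toℕ a))
                          (integral-‿ {geometric ζ (m ℕ.* square a)} (geometric-integral (m ℕ.* square a))))

    conj-p : conj p ≈ 1# - conj ζ
    conj-p = ≐⇒≈ (λ j → cong (ℚ._+ ℚ.- conj ζ j) (conj-1# j))

    conj-u : conj u ≈ 1# + conj ζ
    conj-u = ≐⇒≈ (λ j → cong (ℚ._+ conj ζ j) (conj-1# j))

    conj-p*conj-h≈gauss : conj p * conj h ≈ gauss
    conj-p*conj-h≈gauss = ≈-trans (≈-sym (conj-* p h))
                                  (≈-trans (conj-cong p*h≈conj-gauss) (≐⇒≈ (conj-involutive gauss)))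

    conj-w : conj w ≈ conj E * conj u ^ m * conj h
    conj-w = ≈-trans (conj-* (E * u ^ m) h)
                     (*-congʳ {conj h} (≈-trans (conj-* E (u ^ m)) (*-congˡ {conj E} (conj-^ u m))))

    2-ζ-conjζ≈p*conj-p : (ι (+ 2) - ζ) - conj ζ ≈ p * conj p
    2-ζ-conjζ≈p*conj-p = begin
      (ι (+ 2) - ζ) - conj ζ                               ≈⟨ expand ζ (conj ζ) ⟩
      (1# - ζ) * (1# - conj ζ) + (1# - ζ * conj ζ)         ≈⟨ +-cong (*-congˡ {p} (≈-sym conj-p)) 1-ζ*conjζ≈0 ⟩
      p * conj p + 0#                                      ≈⟨ +-identityʳ (p * conj p) ⟩
      p * conj p                                           ∎
      where
      open SetoidReasoning setoid
      expand : ∀ z z̄ → (ι (+ 2) - z) - z̄ ≈ (1# - z) * (1# - z̄) + (1# - z * z̄)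
      expand = solve 2 (λ z z̄ → (con (+ 2) :- z) :- z̄
                              := (con (+ 1) :- z) :* (con (+ 1) :- z̄) :+ (con (+ 1) :- z :* z̄)) ≈-refl

    [ζ-conjζ]²≈-p*conj-p*u*conj-u : (ζ - conj ζ) ^ 2 ≈ - ((p * conj p) * (u * conj u))
    [ζ-conjζ]²≈-p*conj-p*u*conj-u = begin
      (ζ - conj ζ) ^ 2
        ≈⟨ expand ζ (conj ζ) ⟩
      (1# - ζ * conj ζ) * (1# - ζ * conj ζ) - ((1# - ζ) * (1# - conj ζ)) * ((1# + ζ) * (1# + conj ζ))
        ≈⟨ +-cong (*-cong 1-ζ*conjζ≈0 1-ζ*conjζ≈0)
                  (-‿cong (*-cong (*-congˡ {p} (≈-sym conj-p)) (*-congˡ {u} (≈-sym conj-u)))) ⟩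
      0# * 0# - (p * conj p) * (u * conj u)
        ≈⟨ ≈-trans (+-congʳ { - ((p * conj p) * (u * conj u))} (zeroˡ 0#)) (+-identityˡ _) ⟩
      - ((p * conj p) * (u * conj u)) ∎
      where
      open SetoidReasoning setoid
      expand : ∀ z z̄ → (z - z̄) ^ 2 ≈ (1# - z * z̄) * (1# - z * z̄) - ((1# - z) * (1# - z̄)) * ((1# + z) * (1# + z̄))
      expand = solve 2 (λ z z̄ → (z :- z̄) :^ 2
                              := (con (+ 1) :- z :* z̄) :* (con (+ 1) :- z :* z̄)
                                 :- ((con (+ 1) :- z) :* (con (+ 1) :- z̄)) :* ((con (+ 1) :+ z) :* (con (+ 1) :+ z̄))) ≈-refl

    ℓ*conjE≈conj-p^m : ι (+ ℓ) * conj E ≈ conj p ^ m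
    ℓ*conjE≈conj-p^m = begin
      ι (+ ℓ) * conj E            ≈⟨ *-congʳ {conj E} (≐⇒≈ (conj-const (ℤ→ℚ (+ ℓ)))) ⟨
      conj (ι (+ ℓ)) * conj E     ≈⟨ conj-* (ι (+ ℓ)) E ⟨
      conj (ι (+ ℓ) * E)          ≈⟨ conj-cong ℓE≈p^m ⟩
      conj (p ^ m)                ≈⟨ conj-^ p m ⟩
      conj p ^ m                  ∎
      where open SetoidReasoning setoid

    Q : GR
    Q = (E * conj E) * (u ^ m * conj u ^ m)

    δ*w*conj-w≈Q : δℓ ℓ k * (w * conj w) ≈ Q
    δ*w*conj-w≈Q = begin
      δℓ ℓ k * (w * conj w)
        ≈⟨ *-cong (≐⇒≈ (·≐const* 1/ℓ ((ι (+ 2) - ζ) - conj ζ))) (*-congˡ {w} conj-w) ⟩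
      (L * ((ι (+ 2) - ζ) - conj ζ)) * ((E * u ^ m * h) * (conj E * conj u ^ m * conj h))
        ≈⟨ *-congʳ {(E * u ^ m * h) * (conj E * conj u ^ m * conj h)} (*-congˡ {L} 2-ζ-conjζ≈p*conj-p) ⟩
      (L * (p * conj p)) * ((E * u ^ m * h) * (conj E * conj u ^ m * conj h))
        ≈⟨ regroup L p (conj p) E (u ^ m) h (conj E) (conj u ^ m) (conj h) ⟩
      L * ((p * h) * (conj p * conj h)) * Q
        ≈⟨ *-congʳ {Q} (*-congˡ {L} (*-cong p*h≈conj-gauss conj-p*conj-h≈gauss)) ⟩
      L * (conj gauss * gauss) * Q
        ≈⟨ *-congʳ {Q} (*-congˡ {L} (≈-trans (*-comm (conj gauss) gauss) gauss*conj-gauss≈ℓ)) ⟩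
      L * ι (+ ℓ) * Q
        ≈⟨ *-congʳ {Q} (≈-trans (*-comm L (ι (+ ℓ))) ι[ℓ]*const[1/ℓ]≈1) ⟩
      1# * Q
        ≈⟨ *-identityˡ Q ⟩
      Q ∎
      where
      open SetoidReasoning setoid
      regroup : ∀ l a a′ b c d b′ c′ d′ → (l * (a * a′)) * ((b * c * d) * (b′ * c′ * d′))
                                          ≈ l * ((a * d) * (a′ * d′)) * ((b * b′) * (c * c′))
      regroup = solve 9 (λ l a a′ b c d b′ c′ d′ → (l :* (a :* a′)) :* ((b :* c :* d) :* (b′ :* c′ :* d′))
                                                   := l :* ((a :* d) :* (a′ :* d′)) :* ((b :* b′) :* (c :* c′))) ≈-refl

    α≈Q : αℓ ℓ k ≈ Q
    α≈Q = begin
      αℓ ℓ k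
        ≈⟨ ≐⇒≈ (·≐const* (1/ℓ ℚ.* 1/ℓ) _) ⟩
      const (1/ℓ ℚ.* 1/ℓ) * D._^^_ ℓ (ζ - conj ζ) (2 ℕ.* m)
        ≈⟨ *-cong (const-* 1/ℓ 1/ℓ) (^^≈^ (ζ - conj ζ) (2 ℕ.* m)) ⟩
      (L * L) * (ζ - conj ζ) ^ (2 ℕ.* m)
        ≈⟨ *-congˡ {L * L} (≈-sym (^-assocʳ (ζ - conj ζ) 2 m)) ⟩
      (L * L) * ((ζ - conj ζ) ^ 2) ^ m
        ≈⟨ *-congˡ {L * L} (^-congˡ m [ζ-conjζ]²≈-p*conj-p*u*conj-u) ⟩
      (L * L) * (- ((p * conj p) * (u * conj u))) ^ m
        ≈⟨ *-congˡ {L * L} (^-neg-even ((p * conj p) * (u * conj u)) 2∣m) ⟩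
      (L * L) * ((p * conj p) * (u * conj u)) ^ m
        ≈⟨ *-congˡ {L * L} (≈-trans (^-distrib-* (p * conj p) (u * conj u) m)
                                     (*-cong (^-distrib-* p (conj p) m) (^-distrib-* u (conj u) m))) ⟩
      (L * L) * ((p ^ m * conj p ^ m) * (u ^ m * conj u ^ m))
        ≈⟨ *-congˡ {L * L} (*-congʳ {u ^ m * conj u ^ m} (*-cong (≈-sym ℓE≈p^m) (≈-sym ℓ*conjE≈conj-p^m))) ⟩
      (L * L) * (((ι (+ ℓ) * E) * (ι (+ ℓ) * conj E)) * (u ^ m * conj u ^ m))
        ≈⟨ regroup L (ι (+ ℓ)) E (conj E) (u ^ m * conj u ^ m) ⟩
      ((ι (+ ℓ) * L) * (ι (+ ℓ) * L)) * Q
        ≈⟨ *-congʳ {Q} (*-cong ι[ℓ]*const[1/ℓ]≈1 ι[ℓ]*const[1/ℓ]≈1) ⟩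
      (1# * 1#) * Q
        ≈⟨ ≈-trans (*-congʳ {Q} (*-identityˡ 1#)) (*-identityˡ Q) ⟩
      Q ∎
      where
      open SetoidReasoning setoid
      regroup : ∀ l n e e′ v → (l * l) * (((n * e) * (n * e′)) * v) ≈ ((n * l) * (n * l)) * ((e * e′) * v)
      regroup = solve 5 (λ l n e e′ v → (l :* l) :* (((n :* e) :* (n :* e′)) :* v)
                                        := ((n :* l) :* (n :* l)) :* ((e :* e′) :* v)) ≈-refl

    δ*w*conj-w≈α : δℓ ℓ k * (w * conj w) ≈ αℓ ℓ k
    δ*w*conj-w≈α = ≈-trans δ*w*conj-w≈Q (≈-sym α≈Q)

corollary2p13 : (ℓ : ℕ) .{{_ : NonZero ℓ}} → Prime ℓ → ℓ ≢ 2 →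
    (k : ℕ) → 1 ≤ k → k < ℓ →
    Σ (ℤζ ℓ → ℤζ ℓ) λ f →
      IsLatticeMorphism ℓ (αℓ ℓ k) (δℓ ℓ k) f × Injective ℓ f
corollary2p13 (suc m) isPrime ℓ≢2 k@(suc _) _ k<ℓ =
  mul , mul-isLatticeMorphism {αℓ ℓ k} {δℓ ℓ k} δ*w*conj-w≈α , mul-injective w-unit
  where
  open Cyclotomic m
  open PrimitiveRoot isPrime ℓ≢2 k (>⇒∤ k<ℓ)
  open MultiplicationBy w w-integral
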